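{- Let $n\ge1$ and $m\ge1$. The set of Pak–Stanley labels of the regions of the $n$-dimensional $m$-Catalan arrangement is exactly the set of $m$-Catalan functions of dimension $n$, and the Pak–Stanley labeling is a bijection from the set of regions onto this set.
   Context: $\mathbb N=\{1,2,3,\dots\}$, $[n]=\{1,\dots,n\}$, $\mathbf 1=(1,\dots,1)$. The $n$-dimensional $m$-Catalan arrangement consists of the hyperplanes $\{x\in\mathbb R^n: x_i-x_j=a\}$ for $1\le i<j\le n$ and integers $a\in[-m,m]$; its regions are the connected components of the complement of their union. Let $R_0$ be the region containing the points with $x_1>\dots>x_n$ and $x_1-x_n<1$. The Pak–Stanley label of a region $R$ is $\mathbf 1+\sum_H e_{c(H)}$, summed over the hyperplanes $H$ separating $R$ from $R_0$, where for $H=\{x_i-x_j=a\}$ ($i<j$), $c(H)=j$ if $a>0$ and $c(H)=i$ if $a\le0$ ($e_k$ the standard basis vector). For $\mathbf a\in\mathbb N^n$ and an integer $p$, the $p$-center $Z_p(\mathbf a)$ is the largest subset $X=\{x_1,\dots,x_q\}$ of $[n]$ with $x_q<\dots<x_1$ such that $a_{x_j}\le p+j$ for every $j\in[q]$; $z_p(\mathbf a)=|Z_p(\mathbf a)|$. An $m$-Catalan function of dimension $n$ is $\mathbf a\in\mathbb N^n$ such that $z_{(i-1)m}(\mathbf a)\ge i$ for every $i\in[n]$.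
   Formalization: Regions of the arrangement are represented by points of ℚ^n rather than ℝ^n off all hyperplanes, two points lying in one region when they are on the same side of every hyperplane. -}

module Defs where

open import Data.Nat as ℕ using (ℕ; zero; suc; _≤_; _∸_)
import Data.Nat.Properties as ℕP
open import Data.Integer as ℤ using (ℤ; +_)
open import Data.Rational as ℚ using (ℚ)
import Data.Rational.Properties as ℚP
open import Data.Fin as Fin using (Fin; toℕ)
import Data.Fin.Properties as FinP
open import Data.Bool using (Bool)
import Data.Bool.Properties as BoolP
open import Data.List using (List; []; _∷_; length; filter; allFin; upTo; concatMap; map; lookup)
open import Data.List.Membership.Propositional using (_∈_)
open import Data.List.Relation.Unary.Linked using (Linked)
open import Data.Product using (Σ; _×_; _,_; ∃)
open import Relation.Nullary using (¬_; does)
open import Relation.Nullary.Decidable using (¬?; _×-dec_)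
open import Relation.Binary.PropositionalEquality using (_≡_; _≢_)

Point : ℕ → Set
Point n = Fin n → ℚ

-- A hyperplane  x_i - x_j = a  (meant with i < j).
record Hyp (n : ℕ) : Set where
  constructor hyp
  field
    hi : Fin n
    hj : Fin n
    ha : ℤ
open Hyp public

intRange : ℕ → List ℤ
intRange m = map (λ k → (+ k) ℤ.- (+ m)) (upTo (suc (2 ℕ.* m)))

catalanHyps : (n m : ℕ) → List (Hyp n)
catalanHyps n m =
  concatMap (λ i →
    concatMap (λ j →
      concatMap (λ a → hyp i j a ∷ []) (intRange m))
    (filter (λ j → i Fin.<? j) (allFin n)))
  (allFin n)

form : ∀ {n} → Hyp n → Point n → ℚ
form H x = x (hi H) ℚ.- x (hj H)

const : ∀ {n} → Hyp n → ℚ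
const H = ha H ℚ./ 1

Generic : (n m : ℕ) → Point n → Set
Generic n m x = ∀ H → H ∈ catalanHyps n m → form H x ≢ const H

side : ∀ {n} → Hyp n → Point n → Bool
side H x = does (const H ℚP.<? form H x)

SameRegion : (n m : ℕ) → Point n → Point n → Set
SameRegion n m x y = ∀ H → H ∈ catalanHyps n m → side H x ≡ side H y

-- A fixed point of R_0: x_k = -(k-1)/(n+1) (0-based index k), so that
-- x_1 > ... > x_n and x_1 - x_n < 1.
basePoint : (n : ℕ) → Point n
basePoint n k = (ℤ.- (+ toℕ k)) ℚ./ suc n

Separates : ∀ {n} → Point n → Hyp n → Set
Separates {n} x H = side H x ≢ side H (basePoint n)

colour : ∀ {n} → Hyp n → Fin n
colour H with ha H ℤ.≤? (+ 0)
... | Relation.Nullary.yes _ = hi H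
... | Relation.Nullary.no _ = hj H

psLabel : (n m : ℕ) → Point n → Fin n → ℕ
psLabel n m x k =
  suc (length (filter (λ H → ¬? (side H x BoolP.≟ side H (basePoint n))
                              ×-dec (colour H FinP.≟ k))
                      (catalanHyps n m)))

-- X = {x_1,...,x_q} ⊆ [n] given as the list x_1 ∷ ... ∷ x_q with
-- x_q < ... < x_1, such that a_{x_j} ≤ p + j for all j ∈ [q].
-- (List positions are 0-based, so position t corresponds to j = t+1.)
IsCenterSet : ∀ {n} → ℕ → (Fin n → ℕ) → List (Fin n) → Set
IsCenterSet p a X =
  Linked (λ u v → v Fin.< u) X ×
  (∀ t → a (lookup X t) ≤ p ℕ.+ suc (Fin.toℕ t))

CenterSize : ∀ {n} → ℕ → (Fin n → ℕ) → ℕ → Set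
CenterSize p a k =
  (Σ (List _) λ X → IsCenterSet p a X × length X ≡ k) ×
  (∀ X → IsCenterSet p a X → length X ≤ k)

IsCatalanFn : (n m : ℕ) → (Fin n → ℕ) → Set
IsCatalanFn n m a =
  (∀ k → 1 ≤ a k) ×
  (∀ i → 1 ≤ i → i ≤ n → ∃ λ z → CenterSize ((i ∸ 1) ℕ.* m) a z × i ≤ z)

-- For a generic x, the hyperplanes between coordinates s and k that separate x from R₀ and have
-- colour k number 0 unless x_s > x_k, and otherwise [k < s] plus the number of levels t ∈ [1, m]
-- below x_s − x_k; the label at k is one plus the sum of these contributions.
-- Labels are m-Catalan: the i largest coordinates, by decreasing index, form a centre set for
-- p = (i − 1)m, as each member gets at most m from every other member plus one per member of
-- larger index.
-- Injectivity: grow the set of largest coordinates of x and y together.  If the next largest ones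
-- sat at different indices, their labels in x and in y would bound two level counts strictly by
-- each other; once they coincide, equal labels force equal level counts and hence equal sides
-- of every hyperplane between the new coordinate and the old ones.
-- Surjectivity: place coordinates from the top down, each time the unplaced index of least slack
-- a_s − 1 − #{placed indices above s}, lowered until it sees exactly that many levels (possible
-- by the centre condition and a discrete intermediate value argument).  Integer coordinates
-- with a doubling scale and an odd new coordinate keep the point generic.

module Submission where

open import Defs
open import Data.Bool using (Bool; true; false; not; _∧_; _∨_; if_then_else_)
import Data.Bool.Properties as BP
open import Data.Empty using (⊥-elim)
open import Data.Fin as F using (Fin; zero; suc; toℕ; inject₁; fromℕ; fromℕ<)
import Data.Fin.Properties as FP
open import Data.Integer as ℤ using (ℤ; +_; -[1+_]; +[1+_])
import Data.Integer.Properties as ℤP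
import Data.Integer.Solver as ℤS
open import Data.List using (List; []; _∷_; _++_; length; filter; map; concatMap; allFin; upTo; applyUpTo; tabulate; lookup)
open import Data.List.Membership.Propositional using (_∈_; find; lose)
import Data.List.Membership.Propositional.Properties as MP
open import Data.List.Relation.Unary.All as All using (All; []; _∷_)
import Data.List.Relation.Unary.All.Properties as AllP
open import Data.List.Relation.Unary.Any using (here)
open import Data.List.Relation.Unary.Linked as Lk using (Linked; []; [-]; _∷_)
import Data.List.Relation.Unary.Linked.Properties as LkP
open import Data.Nat
open import Data.Nat.Properties
open import Algebra.Properties.Semiring.Sum +-*-semiring using (sum; sum-cong-≗; ∑-distrib-+; sum-init-last; *-distribˡ-sum)
open import Data.Nat.Solver using (module +-*-Solver)
open import Data.Product using (Σ; _×_; _,_; ∃; proj₁; proj₂)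
open import Data.Rational as ℚ using (ℚ; 0ℚ)
import Data.Rational.Properties as ℚP
import Data.Rational.Solver as ℚS
open import Data.Rational.Unnormalised as U using (mkℚᵘ)
import Data.Rational.Unnormalised.Properties as UP
open import Data.Sum using (_⊎_; inj₁; inj₂)
open import Function using (_∘_; id; _⇔_; mk⇔; Equivalence)
open import Relation.Binary.Bundles using (TotalPreorder)
import Relation.Binary.Construct.Flip.EqAndOrd as Flip
open import Relation.Binary.Definitions using (tri<; tri≈; tri>)
open import Relation.Binary.PropositionalEquality
open import Relation.Nullary using (¬_; Dec; yes; no; does)
open import Relation.Nullary.Decidable using (¬?; _×-dec_; dec-true; dec-false)
open import Relation.Unary using (Pred; Decidable)

-- Counting over Fin n

𝟙 : Bool → ℕ
𝟙 true = 1
𝟙 false = 0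

𝟙≤1 : ∀ b → 𝟙 b ≤ 1
𝟙≤1 true = ≤-refl
𝟙≤1 false = z≤n

𝟙-∧ : ∀ b c → 𝟙 (b ∧ c) ≡ 𝟙 b * 𝟙 c
𝟙-∧ true c = sym (+-identityʳ (𝟙 c))
𝟙-∧ false c = refl

𝟙-mono : ∀ b c → (b ≡ true → c ≡ true) → 𝟙 b ≤ 𝟙 c
𝟙-mono false c _ = z≤n
𝟙-mono true c imp rewrite imp refl = ≤-refl

𝟙-guard : ∀ b {X Y} → (b ≡ true → X ≡ Y) → 𝟙 b * X ≡ 𝟙 b * Y
𝟙-guard true X≡Y = cong (1 *_) (X≡Y refl)
𝟙-guard false _ = refl

dec-true⁻¹ : ∀ {P : Set} (d : Dec P) → does d ≡ true → P
dec-true⁻¹ (yes p) _ = p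

does-⇔ : ∀ {P Q : Set} → (P → Q) → (Q → P) → (p : Dec P) (q : Dec Q) → does p ≡ does q
does-⇔ f g (yes p) q = sym (dec-true q (f p))
does-⇔ f g (no ¬p) q = sym (dec-false q (λ x → ¬p (g x)))

not-does-⇔ : ∀ {P Q : Set} → (¬ P → Q) → (Q → ¬ P) → (p : Dec P) (q : Dec Q) → not (does p) ≡ does q
not-does-⇔ f g (yes p) q = sym (dec-false q (λ z → g z p))
not-does-⇔ f g (no ¬p) q = sym (dec-true q (f ¬p))

true≢false : true ≢ false
true≢false ()

sum-zero : ∀ {n} {f : Fin n → ℕ} → (∀ i → f i ≡ 0) → sum f ≡ 0
sum-zero {zero} _ = refl
sum-zero {suc n} e rewrite e zero = sum-zero (e ∘ suc)

sum-single : ∀ {n} {f : Fin n → ℕ} (k : Fin n) → (∀ i → i ≢ k → f i ≡ 0) → sum f ≡ f k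
sum-single {suc n} {f} zero e =
  trans (cong (_+_ (f zero)) (sum-zero (λ i → e (suc i) (λ ())))) (+-identityʳ _)
sum-single {suc n} {f} (suc k) e =
  trans (cong (_+ sum (f ∘ suc)) (e zero (λ ()))) (sum-single k (λ i i≢k → e (suc i) (i≢k ∘ FP.suc-injective)))

sum-mono-≤ : ∀ {n} {f g : Fin n → ℕ} → (∀ i → f i ≤ g i) → sum f ≤ sum g
sum-mono-≤ {zero} _ = z≤n
sum-mono-≤ {suc n} f≤g = +-mono-≤ (f≤g zero) (sum-mono-≤ (f≤g ∘ suc))

sum-mono-< : ∀ {n} {f g : Fin n → ℕ} (k : Fin n) → (∀ i → f i ≤ g i) → f k < g k → sum f < sum g
sum-mono-< {suc n} zero f≤g lt = +-mono-<-≤ lt (sum-mono-≤ (f≤g ∘ suc))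
sum-mono-< {suc n} (suc k) f≤g lt = +-mono-≤-< (f≤g zero) (sum-mono-< k (f≤g ∘ suc) lt)

sum-const : ∀ {n} c → sum {n} (λ _ → c) ≡ n * c
sum-const {zero} c = refl
sum-const {suc n} c = cong (_+_ c) (sum-const {n} c)

sum-≤-* : ∀ {n} {f : Fin n → ℕ} c → (∀ i → f i ≤ c) → sum f ≤ n * c
sum-≤-* {n} c f≤c = ≤-trans (sum-mono-≤ f≤c) (≤-reflexive (sum-const {n} c))

sum-positive : ∀ {n} (f : Fin n → ℕ) → 1 ≤ sum f → ∃ λ i → 1 ≤ f i
sum-positive {suc n} f pos with f zero in eq
... | suc _ = zero , subst (1 ≤_) (sym eq) (s≤s z≤n)
... | zero with sum-positive (f ∘ suc) pos
...   | i , p = suc i , p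

sum-≤1 : ∀ {n} {f : Fin n → ℕ} → (∀ i → f i ≤ 1) → (∀ i j → 1 ≤ f i → 1 ≤ f j → i ≡ j) → sum f ≤ 1
sum-≤1 {zero} _ _ = z≤n
sum-≤1 {suc n} {f} f≤1 unique with f zero in eq
... | zero = sum-≤1 (f≤1 ∘ suc) (λ i j p q → FP.suc-injective (unique (suc i) (suc j) p q))
... | suc k = subst (λ v → v + sum (f ∘ suc) ≤ 1) eq
                (≤-trans (≤-reflexive (trans (cong (_+_ (f zero)) (sum-zero rest)) (+-identityʳ _))) (f≤1 zero))
  where
  rest : ∀ i → f (suc i) ≡ 0
  rest i = n<1⇒n≡0 (≰⇒> (λ pos → FP.0≢1+n (unique zero (suc i) (subst (1 ≤_) (sym eq) (s≤s z≤n)) pos)))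

card : ∀ {n} → (Fin n → Bool) → ℕ
card P = sum (λ s → 𝟙 (P s))

∅ : ∀ {n} → Fin n → Bool
∅ _ = false

card-∅ : ∀ {n} → card {n} ∅ ≡ 0
card-∅ {n} = sum-zero {n} (λ _ → refl)

card-full : ∀ {n} (P : Fin n → Bool) → (∀ s → P s ≡ true) → card P ≡ n
card-full {n} P e = trans (sum-cong-≗ (λ s → cong 𝟙 (e s))) (trans (sum-const {n} 1) (*-identityʳ n))

card≡n⇒full : ∀ {n} (P : Fin n → Bool) → card P ≡ n → ∀ i → P i ≡ true
card≡n⇒full {suc n} P e i with P zero in eq
card≡n⇒full {suc n} P e zero | true = eq
card≡n⇒full {suc n} P e (suc i) | true = card≡n⇒full (P ∘ suc) (suc-injective e) i
... | false = ⊥-elim (1+n≰n (subst (_≤ n) e (≤-trans (sum-≤-* 1 (λ j → 𝟙≤1 (P (suc j)))) (≤-reflexive (*-identityʳ n)))))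

δ : ∀ {n} → Fin n → Fin n → ℕ
δ σ s = 𝟙 (does (s F.≟ σ))

δ-refl : ∀ {n} (σ : Fin n) → δ σ σ ≡ 1
δ-refl σ = cong 𝟙 (dec-true (σ F.≟ σ) refl)

δ-≢ : ∀ {n} {σ s : Fin n} → s ≢ σ → δ σ s ≡ 0
δ-≢ {σ = σ} {s} s≢σ = cong 𝟙 (dec-false (s F.≟ σ) s≢σ)

sum-δ : ∀ {n} (σ : Fin n) (g : Fin n → ℕ) → sum (λ s → δ σ s * g s) ≡ g σ
sum-δ σ g = trans (sum-single σ (λ i i≢σ → cong (_* g i) (δ-≢ i≢σ)))
                  (trans (cong (_* g σ) (δ-refl σ)) (+-identityʳ (g σ)))

sum-pairs-δ : ∀ {n} (k : Fin n) (G H : Fin n → Fin n → ℕ) →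
  sum (λ i → sum (λ j → 𝟙 (does (i F.<? j)) * (δ k i * G i j + δ k j * H i j)))
    ≡ sum (λ s → 𝟙 (does (k F.<? s)) * G k s + 𝟙 (does (s F.<? k)) * H s k)
sum-pairs-δ {n} k G H = begin
  sum (λ i → sum (λ j → 𝟙 (does (i F.<? j)) * (δ k i * G i j + δ k j * H i j)))
    ≡⟨ sum-cong-≗ (λ i → trans (sum-cong-≗ (λ j → *-distribˡ-+ (𝟙 (does (i F.<? j))) (δ k i * G i j) (δ k j * H i j)))
                                (∑-distrib-+ (low i) (high i))) ⟩
  sum (λ i → sum (low i) + sum (high i))
    ≡⟨ ∑-distrib-+ (λ i → sum (low i)) (λ i → sum (high i)) ⟩
  sum (λ i → sum (low i)) + sum (λ i → sum (high i))
    ≡⟨ cong₂ _+_ lowSum highSum ⟩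
  sum (λ s → 𝟙 (does (k F.<? s)) * G k s) + sum (λ s → 𝟙 (does (s F.<? k)) * H s k)
    ≡⟨ ∑-distrib-+ (λ s → 𝟙 (does (k F.<? s)) * G k s) (λ s → 𝟙 (does (s F.<? k)) * H s k) ⟨
  sum (λ s → 𝟙 (does (k F.<? s)) * G k s + 𝟙 (does (s F.<? k)) * H s k) ∎
  where
  open ≡-Reasoning
  low high : Fin n → Fin n → ℕ
  low i j = 𝟙 (does (i F.<? j)) * (δ k i * G i j)
  high i j = 𝟙 (does (i F.<? j)) * (δ k j * H i j)
  at-k : ∀ b g → 𝟙 b * (δ k k * g) ≡ 𝟙 b * g
  at-k b g = cong (𝟙 b *_) (trans (cong (_* g) (δ-refl k)) (+-identityʳ g))
  off-k : ∀ b {i} g → i ≢ k → 𝟙 b * (δ k i * g) ≡ 0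
  off-k b g i≢k = trans (cong (λ z → 𝟙 b * (z * g)) (δ-≢ i≢k)) (*-zeroʳ (𝟙 b))
  lowSum : sum (λ i → sum (low i)) ≡ sum (λ s → 𝟙 (does (k F.<? s)) * G k s)
  lowSum = trans (sum-single k (λ i i≢k → sum-zero (λ j → off-k (does (i F.<? j)) (G i j) i≢k)))
                 (sum-cong-≗ (λ j → at-k (does (k F.<? j)) (G k j)))
  highSum : sum (λ i → sum (high i)) ≡ sum (λ s → 𝟙 (does (s F.<? k)) * H s k)
  highSum = sum-cong-≗ (λ i → trans (sum-single k (λ j j≢k → off-k (does (i F.<? j)) (H i j) j≢k)) (at-k (does (i F.<? k)) (H i k)))

insert : ∀ {n} → (Fin n → Bool) → Fin n → Fin n → Bool
insert P σ s = P s ∨ does (s F.≟ σ)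

𝟙-insert : ∀ {n} (P : Fin n → Bool) σ → P σ ≡ false → ∀ s → 𝟙 (insert P σ s) ≡ 𝟙 (P s) + δ σ s
𝟙-insert P σ Pσ s with s F.≟ σ
... | no _ = trans (cong 𝟙 (BP.∨-identityʳ (P s))) (sym (+-identityʳ _))
𝟙-insert P σ Pσ s | yes refl rewrite Pσ = refl

sum-insert : ∀ {n} (P : Fin n → Bool) σ → P σ ≡ false → (g : Fin n → ℕ) →
  sum (λ q → 𝟙 (insert P σ q) * g q) ≡ sum (λ q → 𝟙 (P q) * g q) + g σ
sum-insert P σ Pσ g = begin
  sum (λ q → 𝟙 (insert P σ q) * g q)
    ≡⟨ sum-cong-≗ (λ q → trans (cong (_* g q) (𝟙-insert P σ Pσ q)) (*-distribʳ-+ (g q) (𝟙 (P q)) (δ σ q))) ⟩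
  sum (λ q → 𝟙 (P q) * g q + δ σ q * g q)
    ≡⟨ ∑-distrib-+ (λ q → 𝟙 (P q) * g q) (λ q → δ σ q * g q) ⟩
  sum (λ q → 𝟙 (P q) * g q) + sum (λ q → δ σ q * g q)
    ≡⟨ cong (_+_ (sum (λ q → 𝟙 (P q) * g q))) (sum-δ σ g) ⟩
  sum (λ q → 𝟙 (P q) * g q) + g σ ∎
  where open ≡-Reasoning

sum-restrict-cong : ∀ {n} (P : Fin n → Bool) {g h : Fin n → ℕ} → (∀ q → P q ≡ true → g q ≡ h q) →
  sum (λ q → 𝟙 (P q) * g q) ≡ sum (λ q → 𝟙 (P q) * h q)
sum-restrict-cong P {g} {h} e = sum-cong-≗ pointwise
  where
  pointwise : ∀ q → 𝟙 (P q) * g q ≡ 𝟙 (P q) * h q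
  pointwise q with P q in Pq
  ... | true = cong (1 *_) (e q Pq)
  ... | false = refl

sum-restrict-full : ∀ {n} (P : Fin n → Bool) → (∀ q → P q ≡ true) → (g : Fin n → ℕ) → sum (λ q → 𝟙 (P q) * g q) ≡ sum g
sum-restrict-full P full g = sum-cong-≗ (λ q → trans (cong (λ b → 𝟙 b * g q) (full q)) (+-identityʳ (g q)))

card-insert : ∀ {n} (P : Fin n → Bool) σ → P σ ≡ false → card (insert P σ) ≡ suc (card P)
card-insert P σ Pσ = trans (sum-cong-≗ (λ s → sym (*-identityʳ (𝟙 (insert P σ s)))))
  (trans (sum-insert P σ Pσ (λ _ → 1)) (trans (cong (_+ 1) (sum-cong-≗ (λ s → *-identityʳ (𝟙 (P s))))) (+-comm (card P) 1)))

insert-true : ∀ {n} (P : Fin n → Bool) σ s → insert P σ s ≡ true → P s ≡ true ⊎ s ≡ σ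
insert-true P σ s e with P s | s F.≟ σ
... | true | _ = inj₁ refl
... | false | yes s≡σ = inj₂ s≡σ

insert-false : ∀ {n} (P : Fin n → Bool) σ s → insert P σ s ≡ false → P s ≡ false × s ≢ σ
insert-false P σ s e with P s | s F.≟ σ
... | false | no s≢σ = refl , s≢σ

remove : ∀ {n} → (Fin n → Bool) → Fin n → Fin n → Bool
remove P h q = P q ∧ not (does (q F.≟ h))

remove-false : ∀ {n} (P : Fin n → Bool) h q → remove P h q ≡ false → q ≢ h → P q ≡ false
remove-false P h q e q≢h with P q | q F.≟ h
... | false | _ = refl
... | true | yes q≡h = ⊥-elim (q≢h q≡h)

sum-remove : ∀ {n} (P : Fin n → Bool) h → P h ≡ true → (g : Fin n → ℕ) →
  sum (λ q → 𝟙 (P q) * g q) ≡ sum (λ q → 𝟙 (remove P h q) * g q) + g h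
sum-remove P h Ph g = begin
  sum (λ q → 𝟙 (P q) * g q)                          ≡⟨ sum-cong-≗ split ⟩
  sum (λ q → 𝟙 (remove P h q) * g q + δ h q * g q)   ≡⟨ ∑-distrib-+ (λ q → 𝟙 (remove P h q) * g q) (λ q → δ h q * g q) ⟩
  sum (λ q → 𝟙 (remove P h q) * g q) + sum (λ q → δ h q * g q) ≡⟨ cong (_+_ (sum (λ q → 𝟙 (remove P h q) * g q))) (sum-δ h g) ⟩
  sum (λ q → 𝟙 (remove P h q) * g q) + g h           ∎
  where
  open ≡-Reasoning
  split : ∀ q → 𝟙 (P q) * g q ≡ 𝟙 (remove P h q) * g q + δ h q * g q
  split q with q F.≟ h
  ... | yes refl rewrite Ph = refl
  ... | no _ rewrite BP.∧-identityʳ (P q) = sym (+-identityʳ _)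

card-remove : ∀ {n} (P : Fin n → Bool) h → P h ≡ true → card P ≡ suc (card (remove P h))
card-remove P h Ph = trans (sum-cong-≗ (λ s → sym (*-identityʳ (𝟙 (P s)))))
  (trans (sum-remove P h Ph (λ _ → 1)) (trans (cong (_+ 1) (sum-cong-≗ (λ s → *-identityʳ (𝟙 (remove P h s))))) (+-comm (card (remove P h)) 1)))

module _ {c ℓ₁ ℓ₂} (O : TotalPreorder c ℓ₁ ℓ₂) where
  open TotalPreorder O using (_≲_; total) renaming (Carrier to A; refl to ≲-refl; trans to ≲-trans)

  argmax : ∀ {n} (f : Fin n → A) (Q : Fin n → Bool) →
    (∀ s → Q s ≡ false) ⊎ (∃ λ σ → Q σ ≡ true × (∀ s → Q s ≡ true → f s ≲ f σ))
  argmax {zero} f Q = inj₁ (λ ())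
  argmax {suc n} f Q with argmax (f ∘ suc) (Q ∘ suc) | Q zero in Q0
  ... | inj₁ none | false = inj₁ λ { zero → Q0 ; (suc s) → none s }
  ... | inj₁ none | true = inj₂ (zero , Q0 , λ { zero _ → ≲-refl ; (suc s) Qs → ⊥-elim (true≢false (trans (sym Qs) (none s))) })
  ... | inj₂ (σ , Qσ , max) | false = inj₂ (suc σ , Qσ , λ { zero Qs → ⊥-elim (true≢false (trans (sym Qs) Q0)) ; (suc s) Qs → max s Qs })
  ... | inj₂ (σ , Qσ , max) | true with total (f zero) (f (suc σ))
  ...   | inj₁ le = inj₂ (suc σ , Qσ , λ { zero _ → le ; (suc s) Qs → max s Qs })
  ...   | inj₂ ge = inj₂ (zero , Q0 , λ { zero _ → ≲-refl ; (suc s) Qs → ≲-trans (max s Qs) ge })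

-- Fractions with a common denominator

toℚᵘ-/ : ∀ u d → ℚ.toℚᵘ (u ℚ./ suc d) U.≃ mkℚᵘ u d
toℚᵘ-/ u d = ℚP.toℚᵘ-fromℚᵘ (mkℚᵘ u d)

/-sub : ∀ u v d → (u ℚ./ suc d) ℚ.- (v ℚ./ suc d) ≡ (u ℤ.- v) ℚ./ suc d
/-sub u v d = ℚP.toℚᵘ-injective (begin-equality
  ℚ.toℚᵘ ((u ℚ./ suc d) ℚ.- (v ℚ./ suc d))                ≃⟨ ℚP.toℚᵘ-homo-+ (u ℚ./ suc d) (ℚ.- (v ℚ./ suc d)) ⟩
  ℚ.toℚᵘ (u ℚ./ suc d) U.+ ℚ.toℚᵘ (ℚ.- (v ℚ./ suc d))     ≃⟨ UP.+-congʳ (ℚ.toℚᵘ (u ℚ./ suc d)) (ℚP.toℚᵘ-homo‿- (v ℚ./ suc d)) ⟩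
  ℚ.toℚᵘ (u ℚ./ suc d) U.- ℚ.toℚᵘ (v ℚ./ suc d)           ≃⟨ UP.+-cong (toℚᵘ-/ u d) (UP.-‿cong (toℚᵘ-/ v d)) ⟩
  mkℚᵘ u d U.- mkℚᵘ v d                                   ≃⟨ U.*≡* cross ⟩
  mkℚᵘ (u ℤ.- v) d                                        ≃⟨ UP.≃-sym (toℚᵘ-/ (u ℤ.- v) d) ⟩
  ℚ.toℚᵘ ((u ℤ.- v) ℚ./ suc d)                            ∎)
  where
  open UP.≤-Reasoning
  D = + suc d
  cross : (u ℤ.* D ℤ.+ ℤ.- v ℤ.* D) ℤ.* D ≡ (u ℤ.- v) ℤ.* + (suc d * suc d)
  cross = trans (solve 3 (λ u v D → (u :* D :+ (:- v) :* D) :* D := (u :- v) :* (D :* D)) refl u v D)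
                (cong ((u ℤ.- v) ℤ.*_) (sym (ℤP.pos-* (suc d) (suc d))))
    where open ℤS.+-*-Solver

/<⁺ : ∀ a b d e → a ℤ.* + suc e ℤ.< b ℤ.* + suc d → a ℚ./ suc d ℚ.< b ℚ./ suc e
/<⁺ a b d e h = ℚP.toℚᵘ-cancel-< (UP.<-respʳ-≃ (UP.≃-sym (toℚᵘ-/ b e)) (UP.<-respˡ-≃ (UP.≃-sym (toℚᵘ-/ a d)) (U.*<* h)))

/<⁻ : ∀ a b d e → a ℚ./ suc d ℚ.< b ℚ./ suc e → a ℤ.* + suc e ℤ.< b ℤ.* + suc d
/<⁻ a b d e h with UP.<-respʳ-≃ (toℚᵘ-/ b e) (UP.<-respˡ-≃ (toℚᵘ-/ a d) (ℚP.toℚᵘ-mono-< h))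
... | U.*<* h′ = h′

/≤⁺ : ∀ a b d e → a ℤ.* + suc e ℤ.≤ b ℤ.* + suc d → a ℚ./ suc d ℚ.≤ b ℚ./ suc e
/≤⁺ a b d e h = ℚP.toℚᵘ-cancel-≤ (UP.≤-respʳ-≃ (UP.≃-sym (toℚᵘ-/ b e)) (UP.≤-respˡ-≃ (UP.≃-sym (toℚᵘ-/ a d)) (U.*≤* h)))

ι : ℤ → ℚ
ι a = a ℚ./ 1

ι</⁺ : ∀ a w d → a ℤ.* + suc d ℤ.< w → ι a ℚ.< w ℚ./ suc d
ι</⁺ a w d h = /<⁺ a w 0 d (subst (a ℤ.* + suc d ℤ.<_) (sym (ℤP.*-identityʳ w)) h)

ι</⁻ : ∀ a w d → ι a ℚ.< w ℚ./ suc d → a ℤ.* + suc d ℤ.< w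
ι</⁻ a w d h = subst (a ℤ.* + suc d ℤ.<_) (ℤP.*-identityʳ w) (/<⁻ a w 0 d h)

/<ι⁺ : ∀ a w d → w ℤ.< a ℤ.* + suc d → w ℚ./ suc d ℚ.< ι a
/<ι⁺ a w d h = /<⁺ w a d 0 (subst (ℤ._< a ℤ.* + suc d) (sym (ℤP.*-identityʳ w)) h)

ι-mono-< : ∀ {i j} → i ℤ.< j → ι i ℚ.< ι j
ι-mono-< {i} {j} h = /<⁺ i j 0 0 (subst₂ ℤ._<_ (sym (ℤP.*-identityʳ i)) (sym (ℤP.*-identityʳ j)) h)

ι-mono-≤ : ∀ {i j} → i ℤ.≤ j → ι i ℚ.≤ ι j
ι-mono-≤ {i} {j} h = /≤⁺ i j 0 0 (subst₂ ℤ._≤_ (sym (ℤP.*-identityʳ i)) (sym (ℤP.*-identityʳ j)) h)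

ι-sub : ∀ i j → ι (i ℤ.- j) ≡ ι i ℚ.- ι j
ι-sub i j = sym (/-sub i j 0)

module _ where
  open ℚS.+-*-Solver

  neg-involutive : ∀ p → ℚ.- (ℚ.- p) ≡ p
  neg-involutive = solve 1 (λ p → :- (:- p) := p) refl

  neg-sub : ∀ p q → ℚ.- (p ℚ.- q) ≡ q ℚ.- p
  neg-sub = solve 2 (λ p q → :- (p :- q) := q :- p) refl

  sub-+-sub : ∀ p q r → (p ℚ.- q) ℚ.+ (q ℚ.- r) ≡ p ℚ.- r
  sub-+-sub = solve 3 (λ p q r → (p :- q) :+ (q :- r) := p :- r) refl

  sub-sub-sub : ∀ u v w → (u ℚ.- w) ℚ.- (v ℚ.- w) ≡ u ℚ.- v
  sub-sub-sub = solve 3 (λ u v w → (u :- w) :- (v :- w) := u :- v) refl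

  sub-+-cancel : ∀ p q → (q ℚ.- p) ℚ.+ p ≡ q
  sub-+-cancel = solve 2 (λ p q → (q :- p) :+ p := q) refl

ι-neg : ∀ i → ι (ℤ.- i) ≡ ℚ.- ι i
ι-neg (+ zero) = refl
ι-neg +[1+ k ] = refl
ι-neg -[1+ k ] = sym (neg-involutive (ι (+ suc k)))

sub-antimonoʳ-< : ∀ a {b c} → b ℚ.< c → a ℚ.- c ℚ.< a ℚ.- b
sub-antimonoʳ-< a h = ℚP.+-monoʳ-< a (ℚP.neg-antimono-< h)

<⇒sub-pos : ∀ {p q} → p ℚ.< q → 0ℚ ℚ.< q ℚ.- p
<⇒sub-pos {p} {q} h = subst (ℚ._< q ℚ.- p) (ℚP.+-inverseʳ p) (ℚP.+-monoˡ-< (ℚ.- p) h)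

<⇒sub-neg : ∀ {p q} → p ℚ.< q → p ℚ.- q ℚ.< 0ℚ
<⇒sub-neg {p} {q} h = subst (p ℚ.- q ℚ.<_) (ℚP.+-inverseʳ q) (ℚP.+-monoˡ-< (ℚ.- q) h)

sub-neg⇒< : ∀ {p q} → p ℚ.- q ℚ.< 0ℚ → p ℚ.< q
sub-neg⇒< {p} {q} h = subst₂ ℚ._<_ (sub-+-cancel q p) (ℚP.+-identityˡ q) (ℚP.+-monoˡ-< q h)

<-sub⇒sub-<-neg : ∀ {a} p q → a ℚ.< p ℚ.- q → q ℚ.- p ℚ.< ℚ.- a
<-sub⇒sub-<-neg p q h = subst (ℚ._< _) (neg-sub p q) (ℚP.neg-antimono-< h)

sub-<⇒neg-<-sub : ∀ {a} p q → p ℚ.- q ℚ.< a → ℚ.- a ℚ.< q ℚ.- p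
sub-<⇒neg-<-sub p q h = subst (_ ℚ.<_) (neg-sub p q) (ℚP.neg-antimono-< h)

≤∧≢⇒<ℚ : ∀ {p q} → p ℚ.≤ q → p ≢ q → p ℚ.< q
≤∧≢⇒<ℚ {p} {q} p≤q p≢q with ℚP.<-cmp p q
... | tri< p<q _ _ = p<q
... | tri≈ _ p≡q _ = ⊥-elim (p≢q p≡q)
... | tri> _ _ p>q = ⊥-elim (ℚP.<-irrefl refl (ℚP.<-≤-trans p>q p≤q))

-- The hyperplanes of the arrangement

InRange : ℕ → ℤ → Set
InRange m a = ℤ.- (+ m) ℤ.≤ a × a ℤ.≤ + m

InRange-neg : ∀ {m a} → InRange m a → InRange m (ℤ.- a)
InRange-neg {m} {a} (a≥-m , a≤m) = ℤP.neg-mono-≤ a≤m , subst (ℤ.- a ℤ.≤_) (ℤP.neg-involutive (+ m)) (ℤP.neg-mono-≤ a≥-m)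

InRange-pos : ∀ {m t} → t ≤ m → InRange m (+ t)
InRange-pos t≤m = ℤP.≤-trans (ℤP.neg-mono-≤ (ℤ.+≤+ z≤n)) (ℤ.+≤+ z≤n) , ℤ.+≤+ t≤m

InRange-pos⁻ : ∀ {m t} → InRange m +[1+ t ] → suc t ≤ m
InRange-pos⁻ (_ , ℤ.+≤+ le) = le

InRange-neg⁻ : ∀ {m t} → InRange m -[1+ t ] → suc t ≤ m
InRange-neg⁻ {suc m} (ℤ.-≤- le , _) = s≤s le

InRange-sub : ∀ {M u v} → u ≤ M → v ≤ M → InRange M (+ u ℤ.- + v)
InRange-sub {M} {u} {v} u≤M v≤M =
  subst (ℤ._≤ + u ℤ.- + v) (ℤP.+-identityˡ (ℤ.- + M)) (ℤP.+-mono-≤ (ℤ.+≤+ (z≤n {u})) (ℤP.neg-mono-≤ (ℤ.+≤+ v≤M))) ,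
  subst (+ u ℤ.- + v ℤ.≤_) (ℤP.+-identityʳ (+ M)) (ℤP.+-mono-≤ (ℤ.+≤+ u≤M) (ℤP.neg-mono-≤ (ℤ.+≤+ (z≤n {v}))))

module _ (m : ℕ) where
  open ℤS.+-*-Solver

  ∈-intRange⁺ : ∀ {a} → InRange m a → a ∈ intRange m
  ∈-intRange⁺ {a} (a≥-m , a≤m) = subst (_∈ intRange m) shift (MP.∈-map⁺ (λ k → + k ℤ.- + m) (MP.∈-upTo⁺ k<2m+1))
    where
    k = ℤ.∣ a ℤ.+ + m ∣
    +k≡a+m : + k ≡ a ℤ.+ + m
    +k≡a+m = ℤP.0≤i⇒+∣i∣≡i (subst (ℤ._≤ a ℤ.+ + m) (ℤP.+-inverseˡ (+ m)) (ℤP.+-monoˡ-≤ (+ m) a≥-m))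
    shift : + k ℤ.- + m ≡ a
    shift = trans (cong (ℤ._- + m) +k≡a+m) (solve 2 (λ a m → (a :+ m) :- m := a) refl a (+ m))
    k<2m+1 : k < suc (2 * m)
    k<2m+1 with subst₂ ℤ._≤_ (sym +k≡a+m) (sym (ℤP.pos-+ m m)) (ℤP.+-monoˡ-≤ (+ m) a≤m)
    ... | ℤ.+≤+ k≤m+m = s≤s (subst (k ≤_) (cong (_+_ m) (sym (+-identityʳ m))) k≤m+m)

  ∈-intRange⁻ : ∀ {a} → a ∈ intRange m → InRange m a
  ∈-intRange⁻ a∈ with MP.∈-map⁻ (λ k → + k ℤ.- + m) a∈
  ... | k , k∈ , refl = lower , upper
    where
    k≤m+m : k ≤ m + m
    k≤m+m = subst (k ≤_) (cong (_+_ m) (+-identityʳ m)) (≤-pred (MP.∈-upTo⁻ k∈))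
    lower : ℤ.- (+ m) ℤ.≤ + k ℤ.- + m
    lower = subst (ℤ._≤ + k ℤ.- + m) (ℤP.+-identityˡ (ℤ.- (+ m))) (ℤP.+-monoˡ-≤ (ℤ.- (+ m)) (ℤ.+≤+ (z≤n {k})))
    upper : + k ℤ.- + m ℤ.≤ + m
    upper = subst (+ k ℤ.- + m ℤ.≤_) (trans (cong (ℤ._- + m) (ℤP.pos-+ m m)) (solve 1 (λ m → (m :+ m) :- m := m) refl (+ m)))
           (ℤP.+-monoˡ-≤ (ℤ.- (+ m)) (ℤ.+≤+ k≤m+m))

module _ (n m : ℕ) where

  private
    pairs : Fin n → Fin n → List (Hyp n)
    pairs i j = concatMap (λ a → hyp i j a ∷ []) (intRange m)

    row : Fin n → List (Hyp n)
    row i = concatMap (pairs i) (filter (λ j → i F.<? j) (allFin n))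

  ∈-catalanHyps⁺ : ∀ {i j a} → i F.< j → InRange m a → hyp i j a ∈ catalanHyps n m
  ∈-catalanHyps⁺ {i} {j} i<j a∈ =
    MP.∈-concatMap⁺ row (lose (MP.∈-allFin i)
      (MP.∈-concatMap⁺ (pairs i) (lose (MP.∈-filter⁺ (λ j → i F.<? j) (MP.∈-allFin j) i<j)
        (MP.∈-concatMap⁺ (λ a → hyp i j a ∷ []) (lose (∈-intRange⁺ m a∈) (here refl))))))

  ∈-catalanHyps⁻ : ∀ {H} → H ∈ catalanHyps n m → hi H F.< hj H × InRange m (ha H)
  ∈-catalanHyps⁻ H∈ with find (MP.∈-concatMap⁻ row {xs = allFin n} H∈)
  ... | i , _ , H∈row with find (MP.∈-concatMap⁻ (pairs i) {xs = filter (λ j → i F.<? j) (allFin n)} H∈row)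
  ... | j , j∈ , H∈pairs with find (MP.∈-concatMap⁻ (λ a → hyp i j a ∷ []) {xs = intRange m} H∈pairs)
  ... | a , a∈ , here refl = proj₂ (MP.∈-filter⁻ (λ j → i F.<? j) {xs = allFin n} j∈) , ∈-intRange⁻ m a∈

Separated : ∀ {n} → ℕ → Point n → Fin n → Fin n → Set
Separated m x i j = ∀ a → InRange m a → x i ℚ.- x j ≢ ι a

generic⇒separated : ∀ {n m x} → Generic n m x → ∀ i j → i ≢ j → Separated m x i j
generic⇒separated {n} {m} {x} gen i j i≢j a a∈ eq with <-cmp (toℕ i) (toℕ j)
... | tri< i<j _ _ = gen (hyp i j a) (∈-catalanHyps⁺ n m i<j a∈) eq
... | tri≈ _ i≡j _ = i≢j (FP.toℕ-injective i≡j)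
... | tri> _ _ j<i = gen (hyp j i (ℤ.- a)) (∈-catalanHyps⁺ n m j<i (InRange-neg a∈))
                         (trans (sym (neg-sub (x i) (x j))) (trans (cong ℚ.-_ eq) (sym (ι-neg a))))

separated⇒≢ : ∀ {n m} {x : Point n} {s k} → Separated m x s k → x s ≢ x k
separated⇒≢ {x = x} {s} sep xs≡xk = sep (+ 0) (InRange-pos z≤n) (trans (cong (ℚ._-_ (x s)) (sym xs≡xk)) (ℚP.+-inverseʳ (x s)))

-- The label as a sum of pair contributions

sumOver : ∀ {A : Set} → List A → (A → ℕ) → ℕ
sumOver [] g = 0
sumOver (x ∷ xs) g = g x + sumOver xs g

sumOver-cong : ∀ {A : Set} (xs : List A) {f g : A → ℕ} → (∀ x → f x ≡ g x) → sumOver xs f ≡ sumOver xs g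
sumOver-cong [] e = refl
sumOver-cong (x ∷ xs) e = cong₂ _+_ (e x) (sumOver-cong xs e)

sumOver-map : ∀ {A B : Set} (h : A → B) (xs : List A) (g : B → ℕ) → sumOver (map h xs) g ≡ sumOver xs (g ∘ h)
sumOver-map h [] g = refl
sumOver-map h (x ∷ xs) g = cong (_+_ (g (h x))) (sumOver-map h xs g)

sumOver-filter : ∀ {A : Set} {p} {P : Pred A p} (P? : Decidable P) (xs : List A) (g : A → ℕ) →
  sumOver (filter P? xs) g ≡ sumOver xs (λ x → 𝟙 (does (P? x)) * g x)
sumOver-filter P? [] g = refl
sumOver-filter P? (x ∷ xs) g with does (P? x)
... | true = cong₂ _+_ (sym (+-identityʳ (g x))) (sumOver-filter P? xs g)
... | false = sumOver-filter P? xs g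

sumOver-tabulate : ∀ {A : Set} {n} (f : Fin n → A) (g : A → ℕ) → sumOver (tabulate f) g ≡ sum (g ∘ f)
sumOver-tabulate {n = zero} f g = refl
sumOver-tabulate {n = suc n} f g = cong (_+_ (g (f zero))) (sumOver-tabulate (f ∘ suc) g)

sumOver-applyUpTo : ∀ {A : Set} N (f : ℕ → A) (g : A → ℕ) → sumOver (applyUpTo f N) g ≡ sum {N} (λ k → g (f (toℕ k)))
sumOver-applyUpTo zero f g = refl
sumOver-applyUpTo (suc N) f g = cong (_+_ (g (f 0))) (sumOver-applyUpTo N (f ∘ suc) g)

count : ∀ {A : Set} {p} {P : Pred A p} → Decidable P → List A → ℕ
count P? xs = length (filter P? xs)

count-++ : ∀ {A : Set} {p} {P : Pred A p} (P? : Decidable P) (xs ys : List A) → count P? (xs ++ ys) ≡ count P? xs + count P? ys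
count-++ P? [] ys = refl
count-++ P? (x ∷ xs) ys with does (P? x)
... | true = cong suc (count-++ P? xs ys)
... | false = count-++ P? xs ys

count-concatMap : ∀ {A B : Set} {p} {P : Pred B p} (P? : Decidable P) (f : A → List B) (xs : List A) →
  count P? (concatMap f xs) ≡ sumOver xs (count P? ∘ f)
count-concatMap P? f [] = refl
count-concatMap P? f (x ∷ xs) = trans (count-++ P? (f x) (concatMap f xs)) (cong (_+_ (count P? (f x))) (count-concatMap P? f xs))

count-[-] : ∀ {A : Set} {p} {P : Pred A p} (P? : Decidable P) (x : A) → count P? (x ∷ []) ≡ 𝟙 (does (P? x))
count-[-] P? x with does (P? x)
... | true = refl
... | false = refl

sumTo : ℕ → (ℕ → ℕ) → ℕ
sumTo N h = sum {N} (h ∘ toℕ)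

sumTo-cong : ∀ N {h h′} → (∀ t → h t ≡ h′ t) → sumTo N h ≡ sumTo N h′
sumTo-cong N e = sum-cong-≗ {N} (e ∘ toℕ)

sumTo-suc : ∀ N h → sumTo (suc N) h ≡ sumTo N h + h N
sumTo-suc N h = trans (sum-init-last {N} (h ∘ toℕ))
  (cong₂ _+_ (sum-cong-≗ {N} (λ i → cong h (FP.toℕ-inject₁ i))) (cong h (FP.toℕ-fromℕ N)))

sumSym : ℕ → (ℤ → ℕ) → ℕ
sumSym m g = sumTo (suc (2 * m)) (λ t → g (+ t ℤ.- + m))

sumOver-intRange : ∀ m g → sumOver (intRange m) g ≡ sumSym m g
sumOver-intRange m g = trans (sumOver-map (λ k → + k ℤ.- + m) (upTo (suc (2 * m))) g)
                             (sumOver-applyUpTo (suc (2 * m)) (λ k → k) (λ k → g (+ k ℤ.- + m)))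

sumSym-zero : ∀ g → sumSym 0 g ≡ g (+ 0)
sumSym-zero g = +-identityʳ _

sumSym-suc : ∀ m g → sumSym (suc m) g ≡ sumSym m g + (g (+ suc m) + g -[1+ m ])
sumSym-suc m g = begin
  sumSym (suc m) g                                            ≡⟨ cong (λ N → sumTo (suc N) h) 2[1+m]≡2+2m ⟩
  h 0 + sumTo (suc (suc (2 * m))) (h ∘ suc)                   ≡⟨ cong (_+_ (h 0)) (sumTo-suc (suc (2 * m)) (h ∘ suc)) ⟩
  h 0 + (sumTo (suc (2 * m)) (h ∘ suc) + h (suc (suc (2 * m)))) ≡⟨ cong₂ (λ u v → h 0 + (u + v)) middle (cong g top) ⟩
  g -[1+ m ] + (sumSym m g + g (+ suc m))                     ≡⟨ +-comm (g -[1+ m ]) _ ⟩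
  sumSym m g + g (+ suc m) + g -[1+ m ]                       ≡⟨ +-assoc (sumSym m g) _ _ ⟩
  sumSym m g + (g (+ suc m) + g -[1+ m ])                     ∎
  where
  open ≡-Reasoning
  h : ℕ → ℕ
  h t = g (+ t ℤ.- + suc m)
  2[1+m]≡2+2m : 2 * suc m ≡ suc (suc (2 * m))
  2[1+m]≡2+2m = *-suc 2 m
  middle : sumTo (suc (2 * m)) (h ∘ suc) ≡ sumSym m g
  middle = sumTo-cong (suc (2 * m)) (λ t → cong g (trans (ℤP.m-n≡m⊖n (suc t) (suc m))
             (trans (ℤP.[1+m]⊖[1+n]≡m⊖n t m) (sym (ℤP.m-n≡m⊖n t m)))))
  top : + suc (suc (2 * m)) ℤ.- + suc m ≡ + suc m
  top = trans (ℤP.m-n≡m⊖n (suc (suc (2 * m))) (suc m)) (trans (ℤP.⊖-≥ m+1≤2m+2) (cong +_ 2m+2∸[m+1]))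
    where
    m+1≤2m+2 : suc m ≤ suc (suc (2 * m))
    m+1≤2m+2 = s≤s (≤-trans (m≤m+n m (m + 0)) (n≤1+n _))
    2m+2∸[m+1] : suc (suc (2 * m)) ∸ suc m ≡ suc m
    2m+2∸[m+1] = trans (cong (λ z → suc z ∸ m) (cong (_+_ m) (+-identityʳ m)))
                   (trans (cong (_∸ m) (sym (+-suc m m))) (m+n∸m≡n m (suc m)))

nonPositive : ℤ → Bool
nonPositive a = does (a ℤ.≤? + 0)

colour-hyp : ∀ {n} (i j : Fin n) a → colour (hyp i j a) ≡ (if nonPositive a then i else j)
colour-hyp i j a with a ℤ.≤? + 0
... | yes _ = refl
... | no _ = refl

base-side : ∀ n {i j : Fin n} a → i F.< j → side (hyp i j a) (basePoint n) ≡ nonPositive a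
base-side n {i} {j} a i<j =
  does-⇔ (λ h → ≤0⁻ a (ι</⁻ a (+ d) n (subst (ι a ℚ.<_) gap h)))
         (λ h → subst (ι a ℚ.<_) (sym gap) (ι</⁺ a (+ d) n (≤0⁺ a h)))
         (ι a ℚP.<? (basePoint n i ℚ.- basePoint n j)) (a ℤ.≤? + 0)
  where
  d = toℕ j ∸ toℕ i
  gap : basePoint n i ℚ.- basePoint n j ≡ + d ℚ./ suc n
  gap = trans (/-sub (ℤ.- (+ toℕ i)) (ℤ.- (+ toℕ j)) n) (cong (ℚ._/ suc n) diff)
    where
    diff : (ℤ.- (+ toℕ i)) ℤ.- (ℤ.- (+ toℕ j)) ≡ + d
    diff = trans (solve 2 (λ u v → (:- u) :- (:- v) := v :- u) refl (+ toℕ i) (+ toℕ j))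
                 (trans (ℤP.m-n≡m⊖n (toℕ j) (toℕ i)) (ℤP.⊖-≥ (<⇒≤ i<j)))
      where open ℤS.+-*-Solver
  0<d : 0 < d
  0<d = m<n⇒0<n∸m i<j
  d≤n : d ≤ n
  d≤n = ≤-trans (m∸n≤m (toℕ j) (toℕ i)) (<⇒≤ (FP.toℕ<n j))
  ≤0⁻ : ∀ a → a ℤ.* + suc n ℤ.< + d → a ℤ.≤ + 0
  ≤0⁻ (+ zero) _ = ℤ.+≤+ z≤n
  ≤0⁻ +[1+ k ] (ℤ.+<+ h) = ⊥-elim (<⇒≱ h (≤-trans (≤-trans d≤n (n≤1+n n)) (m≤m+n (suc n) (k * suc n))))
  ≤0⁻ -[1+ k ] _ = ℤ.-≤+
  ≤0⁺ : ∀ a → a ℤ.≤ + 0 → a ℤ.* + suc n ℤ.< + d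
  ≤0⁺ (+ zero) _ = ℤ.+<+ 0<d
  ≤0⁺ +[1+ k ] (ℤ.+≤+ ())
  ≤0⁺ -[1+ k ] _ = ℤ.-<+

separatesWith? : ∀ n (x : Point n) (k : Fin n) → Decidable (λ (H : Hyp n) → ¬ side H x ≡ side H (basePoint n) × colour H ≡ k)
separatesWith? n x k H = ¬? (side H x BP.≟ side H (basePoint n)) ×-dec (colour H F.≟ k)

count-catalanHyps : ∀ n m {p} {D : Pred (Hyp n) p} (D? : Decidable D) →
  count D? (catalanHyps n m) ≡ sum (λ i → sum (λ j → 𝟙 (does (i F.<? j)) * sumSym m (λ a → 𝟙 (does (D? (hyp i j a))))))
count-catalanHyps n m D? =
  trans (count-concatMap D? row (allFin n)) (trans (sumOver-cong (allFin n) rowCount) (sumOver-tabulate {n = n} id _))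
  where
  pairs : Fin n → Fin n → List (Hyp n)
  pairs i j = concatMap (λ a → hyp i j a ∷ []) (intRange m)
  row : Fin n → List (Hyp n)
  row i = concatMap (pairs i) (filter (λ j → i F.<? j) (allFin n))
  pairCount : ∀ i j → count D? (pairs i j) ≡ sumSym m (λ a → 𝟙 (does (D? (hyp i j a))))
  pairCount i j = trans (count-concatMap D? (λ a → hyp i j a ∷ []) (intRange m))
    (trans (sumOver-cong (intRange m) (λ a → count-[-] D? (hyp i j a))) (sumOver-intRange m _))
  rowCount : ∀ i → count D? (row i) ≡ sum (λ j → 𝟙 (does (i F.<? j)) * sumSym m (λ a → 𝟙 (does (D? (hyp i j a)))))
  rowCount i = begin
    count D? (row i)
      ≡⟨ count-concatMap D? (pairs i) (filter (λ j → i F.<? j) (allFin n)) ⟩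
    sumOver (filter (λ j → i F.<? j) (allFin n)) (count D? ∘ pairs i)
      ≡⟨ sumOver-filter (λ j → i F.<? j) (allFin n) (count D? ∘ pairs i) ⟩
    sumOver (allFin n) (λ j → 𝟙 (does (i F.<? j)) * count D? (pairs i j))
      ≡⟨ sumOver-cong (allFin n) (λ j → cong (𝟙 (does (i F.<? j)) *_) (pairCount i j)) ⟩
    sumOver (allFin n) (λ j → 𝟙 (does (i F.<? j)) * sumSym m (λ a → 𝟙 (does (D? (hyp i j a)))))
      ≡⟨ sumOver-tabulate {n = n} id _ ⟩
    sum (λ j → 𝟙 (does (i F.<? j)) * sumSym m (λ a → 𝟙 (does (D? (hyp i j a))))) ∎
    where open ≡-Reasoning

sepLow sepHigh : ∀ {n} → ℕ → Point n → Fin n → Fin n → ℕ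
sepLow m x i j = sumSym m (λ a → 𝟙 (nonPositive a) * 𝟙 (not (side (hyp i j a) x)))
sepHigh m x i j = sumSym m (λ a → 𝟙 (not (nonPositive a)) * 𝟙 (side (hyp i j a) x))

-- The hyperplanes x_i − x_j = a (i < j, {i, j} = {s, k}) that separate x from R₀ and have colour k.
contribution : ∀ {n} → ℕ → Point n → Fin n → Fin n → ℕ
contribution m x s k = 𝟙 (does (k F.<? s)) * sepLow m x k s + 𝟙 (does (s F.<? k)) * sepHigh m x s k

𝟙-separatesWith : ∀ {n} (x : Point n) (k : Fin n) {i j} a → i F.< j →
  𝟙 (does (separatesWith? n x k (hyp i j a)))
    ≡ δ k i * (𝟙 (nonPositive a) * 𝟙 (not (side (hyp i j a) x))) + δ k j * (𝟙 (not (nonPositive a)) * 𝟙 (side (hyp i j a) x))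
𝟙-separatesWith {n} x k {i} {j} a i<j rewrite base-side n a i<j | colour-hyp i j a = table (nonPositive a) (side (hyp i j a) x)
  where
  table : ∀ b s → 𝟙 (not (does (s BP.≟ b)) ∧ does ((if b then i else j) F.≟ k))
                    ≡ δ k i * (𝟙 b * 𝟙 (not s)) + δ k j * (𝟙 (not b) * 𝟙 s)
  table true true = sym (cong₂ _+_ (*-zeroʳ (δ k i)) (*-zeroʳ (δ k j)))
  table true false = sym (trans (cong₂ _+_ (*-identityʳ (δ k i)) (*-zeroʳ (δ k j))) (+-identityʳ (δ k i)))
  table false true = sym (cong₂ _+_ (*-zeroʳ (δ k i)) (*-identityʳ (δ k j)))
  table false false = sym (cong₂ _+_ (*-zeroʳ (δ k i)) (*-zeroʳ (δ k j)))

sumSym-separatesWith : ∀ {n} m (x : Point n) k {i j} → i F.< j →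
  sumSym m (λ a → 𝟙 (does (separatesWith? n x k (hyp i j a)))) ≡ δ k i * sepLow m x i j + δ k j * sepHigh m x i j
sumSym-separatesWith m x k {i} {j} i<j = begin
  sumSym m (λ a → 𝟙 (does (separatesWith? _ x k (hyp i j a))))
    ≡⟨ sumTo-cong (suc (2 * m)) (λ t → 𝟙-separatesWith x k (+ t ℤ.- + m) i<j) ⟩
  sum (λ t → δ k i * lowTerm (shift t) + δ k j * highTerm (shift t))
    ≡⟨ ∑-distrib-+ (λ t → δ k i * lowTerm (shift t)) (λ t → δ k j * highTerm (shift t)) ⟩
  sum (λ t → δ k i * lowTerm (shift t)) + sum (λ t → δ k j * highTerm (shift t))
    ≡⟨ cong₂ _+_ (*-distribˡ-sum (δ k i) (lowTerm ∘ shift)) (*-distribˡ-sum (δ k j) (highTerm ∘ shift)) ⟨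
  δ k i * sepLow m x i j + δ k j * sepHigh m x i j ∎
  where
  open ≡-Reasoning
  shift : Fin (suc (2 * m)) → ℤ
  shift t = + toℕ t ℤ.- + m
  lowTerm highTerm : ℤ → ℕ
  lowTerm a = 𝟙 (nonPositive a) * 𝟙 (not (side (hyp i j a) x))
  highTerm a = 𝟙 (not (nonPositive a)) * 𝟙 (side (hyp i j a) x)

psLabel-contributions : ∀ n m (x : Point n) k → psLabel n m x k ≡ suc (sum (λ s → contribution m x s k))
psLabel-contributions n m x k = cong suc (begin
  count (separatesWith? n x k) (catalanHyps n m)
    ≡⟨ count-catalanHyps n m (separatesWith? n x k) ⟩
  sum (λ i → sum (λ j → 𝟙 (does (i F.<? j)) * sumSym m (λ a → 𝟙 (does (separatesWith? n x k (hyp i j a))))))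
    ≡⟨ sum-cong-≗ (λ i → sum-cong-≗ (λ j → 𝟙-guard (does (i F.<? j)) (sumSym-separatesWith m x k ∘ dec-true⁻¹ (i F.<? j)))) ⟩
  sum (λ i → sum (λ j → 𝟙 (does (i F.<? j)) * (δ k i * sepLow m x i j + δ k j * sepHigh m x i j)))
    ≡⟨ sum-pairs-δ k (sepLow m x) (sepHigh m x) ⟩
  sum (λ s → contribution m x s k) ∎)
  where open ≡-Reasoning

levels : ∀ {n} → ℕ → Point n → Fin n → Fin n → ℕ
levels M x s k = sumTo M (λ t → 𝟙 (side (hyp s k (+ suc t)) x))

levels≤ : ∀ {n} m (x : Point n) s k → levels m x s k ≤ m
levels≤ m x s k = ≤-trans (sum-≤-* {m} 1 (λ t → 𝟙≤1 _)) (≤-reflexive (*-identityʳ m))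

side-negate : ∀ {n m} {x : Point n} {s k} → Separated m x s k → ∀ {t} → suc t ≤ m →
  side (hyp k s -[1+ t ]) x ≡ not (side (hyp s k (+ suc t)) x)
side-negate {x = x} {s} {k} sep {t} t<m = sym (not-does-⇔
  (λ ¬t+1<d → subst (ℚ._< x k ℚ.- x s) (sym (ι-neg (+ suc t)))
                 (sub-<⇒neg-<-sub (x s) (x k) (≤∧≢⇒<ℚ (ℚP.≮⇒≥ ¬t+1<d) (sep (+ suc t) (InRange-pos t<m)))))
  (λ -t-1<-d t+1<d → ℚP.<-asym -t-1<-d (subst (x k ℚ.- x s ℚ.<_) (sym (ι-neg (+ suc t))) (<-sub⇒sub-<-neg (x s) (x k) t+1<d)))
  (ι (+ suc t) ℚP.<? (x s ℚ.- x k)) (ι -[1+ t ] ℚP.<? (x k ℚ.- x s)))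

module _ {n : ℕ} (x : Point n) where

  sepHigh-levels : ∀ s k M → sumSym M (λ a → 𝟙 (not (nonPositive a)) * 𝟙 (side (hyp s k a) x)) ≡ levels M x s k
  sepHigh-levels s k zero = sumSym-zero (λ a → 𝟙 (not (nonPositive a)) * 𝟙 (side (hyp s k a) x))
  sepHigh-levels s k (suc M) = begin
    sumSym (suc M) (λ a → 𝟙 (not (nonPositive a)) * 𝟙 (side (hyp s k a) x))
      ≡⟨ sumSym-suc M (λ a → 𝟙 (not (nonPositive a)) * 𝟙 (side (hyp s k a) x)) ⟩
    sumSym M (λ a → 𝟙 (not (nonPositive a)) * 𝟙 (side (hyp s k a) x)) + (𝟙 (side (hyp s k (+ suc M)) x) + 0 + 0)
      ≡⟨ cong₂ _+_ (sepHigh-levels s k M) (trans (+-identityʳ _) (+-identityʳ _)) ⟩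
    levels M x s k + 𝟙 (side (hyp s k (+ suc M)) x)
      ≡⟨ sumTo-suc M (λ t → 𝟙 (side (hyp s k (+ suc t)) x)) ⟨
    levels (suc M) x s k ∎
    where open ≡-Reasoning

  sepLow-levels : ∀ {m} s k → x k ℚ.< x s → Separated m x s k → ∀ M → M ≤ m →
    sumSym M (λ a → 𝟙 (nonPositive a) * 𝟙 (not (side (hyp k s a) x))) ≡ suc (levels M x s k)
  sepLow-levels s k xk<xs sep zero _ =
    trans (sumSym-zero (λ a → 𝟙 (nonPositive a) * 𝟙 (not (side (hyp k s a) x))))
          (cong (λ b → 𝟙 (not b) + 0) (dec-false (ι (+ 0) ℚP.<? (x k ℚ.- x s)) (ℚP.<-asym (<⇒sub-neg xk<xs))))
  sepLow-levels s k xk<xs sep (suc M) M<m = begin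
    sumSym (suc M) (λ a → 𝟙 (nonPositive a) * 𝟙 (not (side (hyp k s a) x)))
      ≡⟨ sumSym-suc M (λ a → 𝟙 (nonPositive a) * 𝟙 (not (side (hyp k s a) x))) ⟩
    sumSym M (λ a → 𝟙 (nonPositive a) * 𝟙 (not (side (hyp k s a) x))) + (0 + (𝟙 (not (side (hyp k s -[1+ M ]) x)) + 0))
      ≡⟨ cong₂ _+_ (sepLow-levels s k xk<xs sep M (≤-trans (n≤1+n M) M<m)) (trans (+-identityʳ _) (cong 𝟙 flip-side)) ⟩
    suc (levels M x s k + 𝟙 (side (hyp s k (+ suc M)) x))
      ≡⟨ cong suc (sumTo-suc M (λ t → 𝟙 (side (hyp s k (+ suc t)) x))) ⟨
    suc (levels (suc M) x s k) ∎
    where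
    open ≡-Reasoning
    flip-side : not (side (hyp k s -[1+ M ]) x) ≡ side (hyp s k (+ suc M)) x
    flip-side = trans (cong not (side-negate {x = x} {s} {k} sep M<m)) (BP.not-involutive (side (hyp s k (+ suc M)) x))

  contribution-self : ∀ m k → contribution m x k k ≡ 0
  contribution-self m k rewrite dec-false (k F.<? k) (<-irrefl refl) = refl

  contribution-below : ∀ m s k → x s ℚ.< x k → contribution m x s k ≡ 0
  contribution-below m s k xs<xk =
    cong₂ _+_ (trans (cong (𝟙 (does (k F.<? s)) *_) (sum-zero {suc (2 * m)} (lowTerm ∘ shift))) (*-zeroʳ (𝟙 (does (k F.<? s)))))
              (trans (cong (𝟙 (does (s F.<? k)) *_) (sum-zero {suc (2 * m)} (highTerm ∘ shift))) (*-zeroʳ (𝟙 (does (s F.<? k)))))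
    where
    shift : Fin (suc (2 * m)) → ℤ
    shift t = + toℕ t ℤ.- + m
    lowTerm : ∀ a → 𝟙 (nonPositive a) * 𝟙 (not (side (hyp k s a) x)) ≡ 0
    lowTerm a with a ℤ.≤? + 0
    ... | no _ = refl
    ... | yes a≤0 rewrite dec-true (ι a ℚP.<? (x k ℚ.- x s)) (ℚP.≤-<-trans (ι-mono-≤ a≤0) (<⇒sub-pos xs<xk)) = refl
    highTerm : ∀ a → 𝟙 (not (nonPositive a)) * 𝟙 (side (hyp s k a) x) ≡ 0
    highTerm a with a ℤ.≤? + 0
    ... | yes _ = refl
    ... | no a≰0 rewrite dec-false (ι a ℚP.<? (x s ℚ.- x k))
                           (λ a<d → ℚP.<-asym a<d (ℚP.<-trans (<⇒sub-neg xs<xk) (ι-mono-< (ℤP.≰⇒> a≰0)))) = refl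

  contribution-above : ∀ m s k → x k ℚ.< x s → Separated m x s k → contribution m x s k ≡ 𝟙 (does (k F.<? s)) + levels m x s k
  contribution-above m s k xk<xs sep with <-cmp (toℕ k) (toℕ s)
  ... | tri< k<s _ s≮k rewrite dec-true (k F.<? s) k<s | dec-false (s F.<? k) s≮k =
        trans (+-identityʳ _) (trans (+-identityʳ _) (sepLow-levels s k xk<xs sep m ≤-refl))
  ... | tri> k≮s _ s<k rewrite dec-false (k F.<? s) k≮s | dec-true (s F.<? k) s<k =
        trans (+-identityʳ _) (sepHigh-levels s k m)
  ... | tri≈ _ k≡s _ = ⊥-elim (ℚP.<-irrefl (cong x (FP.toℕ-injective k≡s)) xk<xs)

-- Centre sets

Descending : ∀ {n} → List (Fin n) → Set
Descending = Linked (λ u v → v F.< u)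

descending⇒below-head : ∀ {n} {h : Fin n} {X} → Descending (h ∷ X) → All (F._< h) X
descending⇒below-head [-] = []
descending⇒below-head (r ∷ L) = LkP.Linked⇒All (λ p q → <-trans q p) r L

descending-∷ : ∀ {n} {h : Fin n} {X} → All (F._< h) X → Descending X → Descending (h ∷ X)
descending-∷ [] _ = [-]
descending-∷ (p ∷ _) L = p ∷ L

descending-length≤ : ∀ {n} (X : List (Fin n)) b → Descending X → All (λ s → toℕ s < b) X → length X ≤ b
descending-length≤ [] b _ _ = z≤n
descending-length≤ (h ∷ X) b L (h<b ∷ _) =
  ≤-trans (s≤s (descending-length≤ X (toℕ h) (Lk.tail L) (descending⇒below-head L))) h<b

sumOver-zero : ∀ {A : Set} {P : A → Set} (X : List A) (g : A → ℕ) → All P X → (∀ q → P q → g q ≡ 0) → sumOver X g ≡ 0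
sumOver-zero [] g _ _ = refl
sumOver-zero (x ∷ X) g (p ∷ ps) g≡0 rewrite g≡0 x p = sumOver-zero X g ps g≡0

descending-rank : ∀ {n} (X : List (Fin n)) → Descending X → ∀ t → sumOver X (λ q → 𝟙 (does (lookup X t F.<? q))) ≡ toℕ t
descending-rank (h ∷ X) L zero rewrite dec-false (h F.<? h) (<-irrefl refl) =
  sumOver-zero X _ (descending⇒below-head L) (λ q q<h → cong 𝟙 (dec-false (h F.<? q) (<-asym q<h)))
descending-rank (h ∷ X) L (suc t)
  rewrite dec-true (lookup X t F.<? h) (All.lookup (descending⇒below-head L) (MP.∈-lookup t)) =
  cong suc (descending-rank X (Lk.tail L) t)

allFinDesc : ∀ n → List (Fin n)
allFinDesc zero = []
allFinDesc (suc n) = fromℕ n ∷ map inject₁ (allFinDesc n)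

allFinDesc-descending : ∀ n → Descending (allFinDesc n)
allFinDesc-descending zero = []
allFinDesc-descending (suc n) = descending-∷ (below-top (allFinDesc n))
  (LkP.map⁺ (Lk.map (λ {u} {v} v<u → subst₂ _<_ (sym (FP.toℕ-inject₁ v)) (sym (FP.toℕ-inject₁ u)) v<u) (allFinDesc-descending n)))
  where
  below-top : (X : List (Fin n)) → All (F._< fromℕ n) (map inject₁ X)
  below-top [] = []
  below-top (h ∷ X) = subst₂ _<_ (sym (FP.toℕ-inject₁ h)) (sym (FP.toℕ-fromℕ n)) (FP.toℕ<n h) ∷ below-top X

sumOver-allFinDesc : ∀ n (g : Fin n → ℕ) → sumOver (allFinDesc n) g ≡ sum g
sumOver-allFinDesc zero g = refl
sumOver-allFinDesc (suc n) g =
  trans (cong (_+_ (g (fromℕ n))) (trans (sumOver-map inject₁ (allFinDesc n) g) (sumOver-allFinDesc n (g ∘ inject₁))))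
        (trans (+-comm (g (fromℕ n)) _) (sym (sum-init-last g)))

length≡sumOver-1 : ∀ {A : Set} (X : List A) → length X ≡ sumOver X (λ _ → 1)
length≡sumOver-1 [] = refl
length≡sumOver-1 (x ∷ X) = cong suc (length≡sumOver-1 X)

largest : (Q : ℕ → Set) → (∀ k → Dec (Q k)) → ∀ N → (∀ k → Q k → k ≤ N) → ∀ i → Q i →
  ∃ λ z → Q z × (∀ k → Q k → k ≤ z) × i ≤ z
largest Q Q? N bound i Qi with Q? N
... | yes QN = N , QN , bound , bound i Qi
largest Q Q? zero bound i Qi | no ¬QN with bound i Qi
... | z≤n = ⊥-elim (¬QN Qi)
largest Q Q? (suc N) bound i Qi | no ¬QN = largest Q Q? N bound′ i Qi
  where
  bound′ : ∀ k → Q k → k ≤ N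
  bound′ k Qk with m≤n⇒m<n∨m≡n (bound k Qk)
  ... | inj₁ k<1+N = ≤-pred k<1+N
  ... | inj₂ refl = ⊥-elim (¬QN Qk)

module _ {n : ℕ} (a : Fin n → ℕ) where

  HasCentre : ℕ → ℕ → ℕ → Set
  HasCentre p b k = ∃ λ X → (IsCenterSet p a X × All (λ s → toℕ s < b) X) × length X ≡ k

  HasCentreTopped : ℕ → ℕ → ℕ → Set
  HasCentreTopped p b k = ∃ λ k′ → k ≡ suc k′ × Σ (b < n) λ b<n → (a (fromℕ< b<n) ≤ p + 1) × HasCentre (suc p) b k′

  topped⇒hasCentre : ∀ p b k → HasCentreTopped p b k → HasCentre p (suc b) k
  topped⇒hasCentre p b .(suc k′) (k′ , refl , b<n , a≤ , X , ((L , bounds) , below) , refl) =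
    (h ∷ X) , ((descending-∷ (All.map (λ {s} s<b → subst (toℕ s <_) (sym toℕh≡b) s<b) below) L , bounds′) ,
               (≤-reflexive (cong suc toℕh≡b) ∷ All.map m<n⇒m<1+n below)) , refl
    where
    h = fromℕ< b<n
    toℕh≡b : toℕ h ≡ b
    toℕh≡b = FP.toℕ-fromℕ< b<n
    bounds′ : ∀ t → a (lookup (h ∷ X) t) ≤ p + suc (toℕ t)
    bounds′ zero = a≤
    bounds′ (suc t) = ≤-trans (bounds t) (≤-reflexive (sym (+-suc p (suc (toℕ t)))))

  hasCentre⇒topped : ∀ p b k → ¬ HasCentre p b k → HasCentre p (suc b) k → HasCentreTopped p b k
  hasCentre⇒topped p b k ¬old ([] , ((L , bounds) , []) , len) = ⊥-elim (¬old ([] , ((L , bounds) , []) , len))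
  hasCentre⇒topped p b k ¬old ((h ∷ X) , ((L , bounds) , (h≤b ∷ below)) , len) with m<1+n⇒m<n∨m≡n h≤b
  ... | inj₁ h<b = ⊥-elim (¬old ((h ∷ X) , ((L , bounds) , (h<b ∷ All.map (λ s<h → <-trans s<h h<b) (descending⇒below-head L))) , len))
  ... | inj₂ refl = length X , sym len , FP.toℕ<n h ,
        subst (λ z → a z ≤ p + 1) (sym (FP.fromℕ<-toℕ h (FP.toℕ<n h))) (bounds zero) ,
        X , ((Lk.tail L , (λ t → ≤-trans (bounds (suc t)) (≤-reflexive (+-suc p (suc (toℕ t)))))) , descending⇒below-head L) , refl

  hasCentreTopped? : ∀ p b k → (∀ p′ k′ → Dec (HasCentre p′ b k′)) → Dec (HasCentreTopped p b k)
  hasCentreTopped? p b zero _ = no λ { (_ , () , _) }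
  hasCentreTopped? p b (suc k) hasCentre? with b <? n
  ... | no b≮n = no λ { (_ , _ , b<n , _) → b≮n b<n }
  ... | yes b<n with a (fromℕ< b<n) ≤? p + 1 | hasCentre? (suc p) k
  ...   | yes a≤ | yes rest = yes (k , refl , b<n , a≤ , rest)
  ...   | no a≰ | _ = no λ { (_ , refl , b<n′ , a≤ , _) → a≰ (subst (λ z → a (fromℕ< z) ≤ p + 1) (<-irrelevant b<n′ b<n) a≤) }
  ...   | yes _ | no ¬rest = no λ { (_ , refl , _ , _ , rest) → ¬rest rest }

  hasCentre? : ∀ b p k → Dec (HasCentre p b k)
  hasCentre? zero p zero = yes ([] , (([] , λ ()) , []) , refl)
  hasCentre? zero p (suc k) = no λ { ([] , _ , ()) ; ((h ∷ X) , (_ , (h<0 ∷ _)) , _) → n≮0 h<0 }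
  hasCentre? (suc b) p k with hasCentre? b p k
  ... | yes (X , ((L , bounds) , below) , len) = yes (X , ((L , bounds) , All.map m<n⇒m<1+n below) , len)
  ... | no ¬old with hasCentreTopped? p b k (hasCentre? b)
  ...   | yes topped = yes (topped⇒hasCentre p b k topped)
  ...   | no ¬topped = no (λ new → ¬topped (hasCentre⇒topped p b k ¬old new))

  centreSize-exists : ∀ p i → (∃ λ X → IsCenterSet p a X × length X ≡ i) → ∃ λ z → CenterSize p a z × i ≤ z
  centreSize-exists p i centre with largest Q Q? n bound i centre
    where
    Q : ℕ → Set
    Q k = ∃ λ X → IsCenterSet p a X × length X ≡ k
    Q? : ∀ k → Dec (Q k)
    Q? k with hasCentre? n p k
    ... | yes (X , (c , _) , len) = yes (X , c , len)
    ... | no ¬c = no λ { (X , c , len) → ¬c (X , (c , All.universal FP.toℕ<n X) , len) }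
    bound : ∀ k → Q k → k ≤ n
    bound k (X , (L , _) , refl) = descending-length≤ X n L (All.universal FP.toℕ<n X)
  ... | z , Qz , max , i≤z = z , (Qz , (λ X c → max (length X) (X , c , refl))) , i≤z

-- Labels are m-Catalan functions

UpperSet : ∀ {n} → Point n → (Fin n → Bool) → Set
UpperSet x P = ∀ s t → P s ≡ true → P t ≡ false → x t ℚ.< x s

upperSet-∅ : ∀ {n} (x : Point n) → UpperSet x ∅
upperSet-∅ x s t ()

above : ∀ {n} → (Fin n → Bool) → Fin n → ℕ
above P s = sum (λ q → 𝟙 (P q) * 𝟙 (does (s F.<? q)))

𝟙-≟true : ∀ b → 𝟙 (does (b BP.≟ true)) ≡ 𝟙 b
𝟙-≟true true = refl
𝟙-≟true false = refl

module _ {n m : ℕ} {x : Point n} (gen : Generic n m x) where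

  private
    sep : ∀ s k → s ≢ k → Separated m x s k
    sep = generic⇒separated {n} {m} {x} gen

  upperSet-insert : ∀ P → UpperSet x P → card P < n →
    ∃ λ σ → P σ ≡ false × UpperSet x (insert P σ) × (∀ s → P s ≡ false → s ≢ σ → x s ℚ.< x σ)
  upperSet-insert P upper |P|<n with argmax ℚP.≤-totalPreorder x (λ s → not (P s))
  ... | inj₁ none = ⊥-elim (<-irrefl (card-full P (λ s → BP.not-injective (none s))) |P|<n)
  ... | inj₂ (σ , Pσ , max) = σ , BP.not-injective Pσ , upper′ , below
    where
    below : ∀ s → P s ≡ false → s ≢ σ → x s ℚ.< x σ
    below s Ps s≢σ = ≤∧≢⇒<ℚ (max s (cong not Ps)) (separated⇒≢ {x = x} (sep s σ s≢σ))
    upper′ : UpperSet x (insert P σ)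
    upper′ s t Ps Pt with insert-false P σ t Pt | insert-true P σ s Ps
    ... | Pt′ , t≢σ | inj₁ Ps′ = upper s t Ps′ Pt′
    ... | Pt′ , t≢σ | inj₂ refl = below t Pt′ t≢σ

  upperSet-ofSize : ∀ i → i ≤ n → ∃ λ P → UpperSet x P × card P ≡ i
  upperSet-ofSize zero _ = ∅ , upperSet-∅ x , card-∅ {n}
  upperSet-ofSize (suc i) i<n with upperSet-ofSize i (≤-trans (n≤1+n i) i<n)
  ... | P , upper , |P|≡i with upperSet-insert P upper (subst (_< n) (sym |P|≡i) i<n)
  ...   | σ , Pσ , upper′ , _ = insert P σ , upper′ , trans (card-insert P σ Pσ) (cong suc |P|≡i)

  contribution-in-upperSet : ∀ P → UpperSet x P → ∀ s → P s ≡ true → ∀ q →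
    contribution m x q s ≤ 𝟙 (P q) * 𝟙 (does (s F.<? q)) + m * (𝟙 (P q) * 𝟙 (not (does (q F.≟ s))))
  contribution-in-upperSet P upper s Ps q with q F.≟ s
  ... | yes refl = ≤-reflexive′ (contribution-self x m q)
    where
    ≤-reflexive′ : ∀ {a b} → a ≡ 0 → a ≤ b
    ≤-reflexive′ refl = z≤n
  ... | no q≢s with ℚP.<-cmp (x q) (x s)
  ...   | tri< xq<xs _ _ = ≤-trans (≤-reflexive (contribution-below x m q s xq<xs)) z≤n
  ...   | tri≈ _ xq≡xs _ = ⊥-elim (separated⇒≢ {x = x} (sep q s q≢s) xq≡xs)
  ...   | tri> _ _ xs<xq with P q in Pq
  ...     | false = ⊥-elim (ℚP.<-asym xs<xq (upper s q Ps Pq))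
  ...     | true = ≤-trans (≤-reflexive (contribution-above x m q s xs<xq (sep q s q≢s)))
                     (+-mono-≤ (≤-reflexive (sym (+-identityʳ _))) (≤-trans (levels≤ m x q s) (≤-reflexive (sym (*-identityʳ m)))))

  psLabel-in-upperSet : ∀ P → UpperSet x P → ∀ s → P s ≡ true → psLabel n m x s ≤ suc (above P s + m * (card P ∸ 1))
  psLabel-in-upperSet P upper s Ps = begin
    psLabel n m x s
      ≡⟨ psLabel-contributions n m x s ⟩
    suc (sum (λ q → contribution m x q s))
      ≤⟨ s≤s (sum-mono-≤ (contribution-in-upperSet P upper s Ps)) ⟩
    suc (sum (λ q → 𝟙 (P q) * 𝟙 (does (s F.<? q)) + m * others q))
      ≡⟨ cong suc (∑-distrib-+ (λ q → 𝟙 (P q) * 𝟙 (does (s F.<? q))) (λ q → m * others q)) ⟩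
    suc (above P s + sum (λ q → m * others q))
      ≡⟨ cong (λ z → suc (above P s + z)) (*-distribˡ-sum m others) ⟨
    suc (above P s + m * sum others)
      ≡⟨ cong (λ z → suc (above P s + m * z)) |others| ⟩
    suc (above P s + m * (card P ∸ 1)) ∎
    where
    open ≤-Reasoning
    others : Fin n → ℕ
    others q = 𝟙 (P q) * 𝟙 (not (does (q F.≟ s)))
    |others| : sum others ≡ card P ∸ 1
    |others| = trans (sum-cong-≗ (λ q → sym (𝟙-∧ (P q) (not (does (q F.≟ s)))))) (sym (cong (_∸ 1) (card-remove P s Ps)))

  centre-of-upperSet : ∀ i → i ≤ n → ∃ λ X → IsCenterSet ((i ∸ 1) * m) (psLabel n m x) X × length X ≡ i
  centre-of-upperSet i i≤n with upperSet-ofSize i i≤n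
  ... | P , upper , |P|≡i = X , (X-descending , bounded) , |X|≡i
    where
    X = filter (λ q → P q BP.≟ true) (allFinDesc n)
    X-descending : Descending X
    X-descending = LkP.filter⁺ (λ q → P q BP.≟ true) (λ p q → <-trans q p) (allFinDesc-descending n)
    sumOver-X : ∀ h → sumOver X h ≡ sum (λ q → 𝟙 (P q) * h q)
    sumOver-X h = trans (sumOver-filter (λ q → P q BP.≟ true) (allFinDesc n) h)
      (trans (sumOver-allFinDesc n (λ q → 𝟙 (does (P q BP.≟ true)) * h q)) (sum-cong-≗ (λ q → cong (_* h q) (𝟙-≟true (P q)))))
    |X|≡i : length X ≡ i
    |X|≡i = trans (length≡sumOver-1 X) (trans (sumOver-X (λ _ → 1)) (trans (sum-cong-≗ {n} (λ q → *-identityʳ (𝟙 (P q)))) |P|≡i))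
    bounded : ∀ t → psLabel n m x (lookup X t) ≤ (i ∸ 1) * m + suc (toℕ t)
    bounded t = ≤-trans (psLabel-in-upperSet P upper s Ps) (≤-reflexive (begin
      suc (above P s + m * (card P ∸ 1)) ≡⟨ cong₂ (λ u c → suc (u + m * (c ∸ 1))) rank |P|≡i ⟩
      suc (toℕ t + m * (i ∸ 1))          ≡⟨ solve 3 (λ t c m → con 1 :+ (t :+ m :* c) := c :* m :+ (con 1 :+ t)) refl (toℕ t) (i ∸ 1) m ⟩
      (i ∸ 1) * m + suc (toℕ t)          ∎))
      where
      open ≡-Reasoning
      open +-*-Solver
      s = lookup X t
      Ps : P s ≡ true
      Ps = All.lookup (AllP.all-filter (λ q → P q BP.≟ true) (allFinDesc n)) (MP.∈-lookup t)
      rank : above P s ≡ toℕ t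
      rank = trans (sym (sumOver-X (λ q → 𝟙 (does (s F.<? q))))) (descending-rank X X-descending t)

  psLabel-catalan : IsCatalanFn n m (psLabel n m x)
  psLabel-catalan =
    (λ k → subst (1 ≤_) (sym (psLabel-contributions n m x k)) (s≤s z≤n)) ,
    (λ i _ i≤n → centreSize-exists (psLabel n m x) ((i ∸ 1) * m) i (centre-of-upperSet i i≤n))

-- Injectivity

levelsFrom : ∀ {n} → ℕ → Point n → (Fin n → Bool) → Fin n → ℕ
levelsFrom m z P σ = sum (λ q → 𝟙 (P q) * levels m z q σ)

levels-antimono : ∀ {n} m (z : Point n) q {σ s} → z s ℚ.< z σ → levels m z q σ ≤ levels m z q s
levels-antimono m z q {σ} {s} zs<zσ = sum-mono-≤ {m} (λ t → 𝟙-mono _ _ (λ e →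
  dec-true (ι (+ suc (toℕ t)) ℚP.<? (z q ℚ.- z s))
    (ℚP.<-trans (dec-true⁻¹ (ι (+ suc (toℕ t)) ℚP.<? (z q ℚ.- z σ)) e) (sub-antimonoʳ-< (z q) zs<zσ))))

module _ {n m : ℕ} {z : Point n} (gen : Generic n m z) (P : Fin n → Bool) (upper : UpperSet z P)
         (σ : Fin n) (Pσ : P σ ≡ false) (σ-max : ∀ s → P s ≡ false → s ≢ σ → z s ℚ.< z σ) where

  private
    sep : ∀ s k → s ≢ k → Separated m z s k
    sep = generic⇒separated {n} {m} {z} gen
    inP≢σ : ∀ {q} → P q ≡ true → q ≢ σ
    inP≢σ Pq refl = true≢false (trans (sym Pq) Pσ)

  psLabel-next : psLabel n m z σ ≡ suc (above P σ + levelsFrom m z P σ)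
  psLabel-next = trans (psLabel-contributions n m z σ)
    (cong suc (trans (sum-cong-≗ split) (∑-distrib-+ (λ q → 𝟙 (P q) * 𝟙 (does (σ F.<? q))) (λ q → 𝟙 (P q) * levels m z q σ))))
    where
    split : ∀ q → contribution m z q σ ≡ 𝟙 (P q) * 𝟙 (does (σ F.<? q)) + 𝟙 (P q) * levels m z q σ
    split q with P q in Pq
    ... | true = trans (contribution-above z m q σ (upper q σ Pq Pσ) (sep q σ (inP≢σ Pq)))
                       (sym (cong₂ _+_ (+-identityʳ (𝟙 (does (σ F.<? q)))) (+-identityʳ (levels m z q σ))))
    ... | false with q F.≟ σ
    ...   | yes refl = contribution-self z m q
    ...   | no q≢σ = contribution-below z m q σ (σ-max q Pq q≢σ)

  psLabel-other : ∀ s → P s ≡ false → s ≢ σ →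
    suc (above P s + levelsFrom m z P σ + 𝟙 (does (s F.<? σ))) ≤ psLabel n m z s
  psLabel-other s Ps s≢σ = ≤-trans (s≤s (≤-trans (≤-reflexive regroup) (sum-mono-≤ termwise)))
                                   (≤-reflexive (sym (psLabel-contributions n m z s)))
    where
    f g h : Fin n → ℕ
    f q = 𝟙 (P q) * 𝟙 (does (s F.<? q))
    g q = 𝟙 (P q) * levels m z q σ
    h q = δ σ q * 𝟙 (does (s F.<? σ))
    regroup : above P s + levelsFrom m z P σ + 𝟙 (does (s F.<? σ)) ≡ sum (λ q → f q + g q + h q)
    regroup = sym (trans (∑-distrib-+ (λ q → f q + g q) h) (cong₂ _+_ (∑-distrib-+ f g) (sum-δ σ (λ _ → 𝟙 (does (s F.<? σ))))))
    termwise : ∀ q → f q + g q + h q ≤ contribution m z q s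
    termwise q with P q in Pq | q F.≟ σ
    ... | true | yes refl = ⊥-elim (true≢false (trans (sym Pq) Pσ))
    ... | true | no _ = begin
      𝟙 (does (s F.<? q)) + 0 + (levels m z q σ + 0) + 0
        ≡⟨ solve 2 (λ a b → a :+ con 0 :+ (b :+ con 0) :+ con 0 := a :+ b) refl (𝟙 (does (s F.<? q))) (levels m z q σ) ⟩
      𝟙 (does (s F.<? q)) + levels m z q σ
        ≤⟨ +-monoʳ-≤ (𝟙 (does (s F.<? q))) (levels-antimono m z q (σ-max s Ps s≢σ)) ⟩
      𝟙 (does (s F.<? q)) + levels m z q s
        ≡⟨ contribution-above z m q s (upper q s Pq Ps) (sep q s (λ { refl → true≢false (trans (sym Pq) Ps) })) ⟨
      contribution m z q s ∎
      where
      open ≤-Reasoning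
      open +-*-Solver
    ... | false | yes refl = ≤-trans (≤-reflexive (+-identityʳ _))
                               (≤-trans (m≤m+n _ _) (≤-reflexive (sym (contribution-above z m σ s (σ-max s Ps s≢σ) (sep σ s (s≢σ ∘ sym))))))
    ... | false | no _ = z≤n

side-nonpos : ∀ {n} (z : Point n) {q σ} d → z σ ℚ.< z q → d ℤ.≤ + 0 → side (hyp q σ d) z ≡ true
side-nonpos z {q} {σ} d zσ<zq d≤0 = dec-true (ι d ℚP.<? (z q ℚ.- z σ)) (ℚP.≤-<-trans (ι-mono-≤ d≤0) (<⇒sub-pos zσ<zq))

side-nonneg : ∀ {n} (z : Point n) {q σ} d → z σ ℚ.< z q → + 0 ℤ.≤ d → side (hyp σ q d) z ≡ false
side-nonneg z {q} {σ} d zσ<zq 0≤d =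
  dec-false (ι d ℚP.<? (z σ ℚ.- z q)) (λ d<gap → ℚP.<-asym d<gap (ℚP.<-≤-trans (<⇒sub-neg zσ<zq) (ι-mono-≤ 0≤d)))

level-transfer : ∀ {a a₀ : ℤ} {vq vq₀ vσ uq uq₀ uσ : ℚ} →
  ι a ℚ.< vq ℚ.- vσ → vq₀ ℚ.- vσ ℚ.≤ ι a₀ → ι a₀ ℚ.< uq₀ ℚ.- uσ →
  (ι (a ℤ.- a₀) ℚ.< vq ℚ.- vq₀ → ι (a ℤ.- a₀) ℚ.< uq ℚ.- uq₀) → ι a ℚ.< uq ℚ.- uσ
level-transfer {a} {a₀} {vq} {vq₀} {vσ} {uq} {uq₀} {uσ} a<v v₀≤a₀ a₀<u₀ transfer =
  subst₂ ℚ._<_ (trans (cong (ℚ._+ ι a₀) (ι-sub a a₀)) (sub-+-cancel (ι a₀) (ι a))) (sub-+-sub uq uq₀ uσ)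
         (ℚP.+-mono-< (transfer v-gap) a₀<u₀)
  where
  v-gap : ι (a ℤ.- a₀) ℚ.< vq ℚ.- vq₀
  v-gap = subst₂ ℚ._<_ (sym (ι-sub a a₀)) (sub-sub-sub vq vq₀ vσ) (ℚP.+-mono-<-≤ a<v (ℚP.neg-antimono-≤ v₀≤a₀))

module _ {n m : ℕ} (P : Fin n → Bool) (σ : Fin n) where

  Dominates : Point n → Point n → Set
  Dominates u v = ∀ q q′ → P q ≡ true → P q′ ≡ true → ∀ d → InRange m d → side (hyp q q′ d) v ≡ true → side (hyp q q′ d) u ≡ true

  levelsFrom-< : (u v : Point n) → Dominates u v → ∀ q₀ → P q₀ ≡ true → (t₀ : Fin m) →
    side (hyp q₀ σ (+ suc (toℕ t₀))) u ≡ true → side (hyp q₀ σ (+ suc (toℕ t₀))) v ≡ false →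
    levelsFrom m v P σ < levelsFrom m u P σ
  levelsFrom-< u v dom q₀ Pq₀ t₀ u₀ v₀ = sum-mono-< q₀ termwise strict
    where
    α : Fin m → ℤ
    α t = + suc (toℕ t)
    level-v⇒u : ∀ q → P q ≡ true → ∀ t → side (hyp q σ (α t)) v ≡ true → side (hyp q σ (α t)) u ≡ true
    level-v⇒u q Pq t vt = dec-true (ι (α t) ℚP.<? (u q ℚ.- u σ))
      (level-transfer {α t} {α t₀} {v q} {v q₀} {v σ} {u q} {u q₀} {u σ}
        (dec-true⁻¹ (ι (α t) ℚP.<? (v q ℚ.- v σ)) vt)
        (ℚP.≮⇒≥ (λ h → true≢false (trans (sym (dec-true (ι (α t₀) ℚP.<? (v q₀ ℚ.- v σ)) h)) v₀)))
        (dec-true⁻¹ (ι (α t₀) ℚP.<? (u q₀ ℚ.- u σ)) u₀)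
        (λ h → dec-true⁻¹ (ι (α t ℤ.- α t₀) ℚP.<? (u q ℚ.- u q₀))
                 (dom q q₀ Pq Pq₀ (α t ℤ.- α t₀) (InRange-sub (FP.toℕ<n t) (FP.toℕ<n t₀))
                   (dec-true (ι (α t ℤ.- α t₀) ℚP.<? (v q ℚ.- v q₀)) h))))
    levels-v≤u : ∀ q → P q ≡ true → levels m v q σ ≤ levels m u q σ
    levels-v≤u q Pq = sum-mono-≤ {m} (λ t → 𝟙-mono _ _ (level-v⇒u q Pq t))
    termwise : ∀ q → 𝟙 (P q) * levels m v q σ ≤ 𝟙 (P q) * levels m u q σ
    termwise q with P q in Pq
    ... | true = +-monoˡ-≤ 0 (levels-v≤u q Pq)
    ... | false = z≤n
    strict : 𝟙 (P q₀) * levels m v q₀ σ < 𝟙 (P q₀) * levels m u q₀ σ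
    strict rewrite Pq₀ = +-monoˡ-< 0 (sum-mono-< {m} t₀ (λ t → 𝟙-mono _ _ (level-v⇒u q₀ Pq₀ t))
                                        (subst₂ _<_ (sym (cong 𝟙 v₀)) (sym (cong 𝟙 u₀)) (s≤s z≤n)))

module _ {n m : ℕ} {x y : Point n} (gx : Generic n m x) (gy : Generic n m y)
         (same : ∀ k → psLabel n m x k ≡ psLabel n m y k) where

  AgreeOn : (Fin n → Bool) → Set
  AgreeOn P = ∀ q q′ → P q ≡ true → P q′ ≡ true → ∀ d → InRange m d → side (hyp q q′ d) x ≡ side (hyp q q′ d) y

  Invariant : (Fin n → Bool) → Set
  Invariant P = UpperSet x P × UpperSet y P × AgreeOn P

  module _ (P : Fin n → Bool) (inv : Invariant P) where
    private
      upperx : UpperSet x P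
      upperx = proj₁ inv
      uppery : UpperSet y P
      uppery = proj₁ (proj₂ inv)
      agree : AgreeOn P
      agree = proj₂ (proj₂ inv)

    next-coincide : ∀ σ σ′ → P σ ≡ false → P σ′ ≡ false →
      (∀ s → P s ≡ false → s ≢ σ → x s ℚ.< x σ) → (∀ s → P s ≡ false → s ≢ σ′ → y s ℚ.< y σ′) → σ ≡ σ′
    next-coincide σ σ′ Pσ Pσ′ maxx maxy with σ F.≟ σ′
    ... | yes σ≡σ′ = σ≡σ′
    ... | no σ≢σ′ = ⊥-elim (1+n≰n (≤-trans order-gap (+-cancelˡ-≤ X _ _ cycle)))
      where
      X = levelsFrom m x P σ
      Y = levelsFrom m y P σ′
      σ′<σ = 𝟙 (does (σ′ F.<? σ))
      σ<σ′ = 𝟙 (does (σ F.<? σ′))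
      X≤Y : X + σ′<σ ≤ Y
      X≤Y = +-cancelˡ-≤ (above P σ′) _ _ (≤-pred (subst (_≤ suc (above P σ′ + Y)) (cong suc (+-assoc (above P σ′) X σ′<σ))
              (≤-trans (psLabel-other {m = m} gx P upperx σ Pσ maxx σ′ Pσ′ (σ≢σ′ ∘ sym))
                       (≤-reflexive (trans (same σ′) (psLabel-next {m = m} gy P uppery σ′ Pσ′ maxy))))))
      Y≤X : Y + σ<σ′ ≤ X
      Y≤X = +-cancelˡ-≤ (above P σ) _ _ (≤-pred (subst (_≤ suc (above P σ + X)) (cong suc (+-assoc (above P σ) Y σ<σ′))
              (≤-trans (psLabel-other {m = m} gy P uppery σ′ Pσ′ maxy σ Pσ σ≢σ′)
                       (≤-reflexive (trans (sym (same σ)) (psLabel-next {m = m} gx P upperx σ Pσ maxx))))))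
      cycle : X + (σ′<σ + σ<σ′) ≤ X + 0
      cycle = begin
        X + (σ′<σ + σ<σ′) ≡⟨ +-assoc X σ′<σ σ<σ′ ⟨
        X + σ′<σ + σ<σ′   ≤⟨ +-monoˡ-≤ σ<σ′ X≤Y ⟩
        Y + σ<σ′          ≤⟨ Y≤X ⟩
        X                 ≡⟨ +-identityʳ X ⟨
        X + 0             ∎
        where open ≤-Reasoning
      order-gap : 1 ≤ σ′<σ + σ<σ′
      order-gap with <-cmp (toℕ σ) (toℕ σ′)
      ... | tri< σ<σ′ _ _ rewrite dec-true (σ F.<? σ′) σ<σ′ = m≤n+m 1 σ′<σ
      ... | tri> _ _ σ′<σ rewrite dec-true (σ′ F.<? σ) σ′<σ = s≤s z≤n
      ... | tri≈ _ σ≡σ′ _ = ⊥-elim (σ≢σ′ (FP.toℕ-injective σ≡σ′))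

    module _ (σ : Fin n) (Pσ : P σ ≡ false)
             (maxx : ∀ s → P s ≡ false → s ≢ σ → x s ℚ.< x σ) (maxy : ∀ s → P s ≡ false → s ≢ σ → y s ℚ.< y σ) where

      levels-agree : ∀ q → P q ≡ true → ∀ t → suc t ≤ m → side (hyp q σ (+ suc t)) x ≡ side (hyp q σ (+ suc t)) y
      levels-agree q Pq t t<m = subst (λ w → side (hyp q σ (+ suc w)) x ≡ side (hyp q σ (+ suc w)) y) (FP.toℕ-fromℕ< t<m)
                                      (agree-at (fromℕ< t<m))
        where
        X≡Y : levelsFrom m x P σ ≡ levelsFrom m y P σ
        X≡Y = +-cancelˡ-≡ (above P σ) _ _ (suc-injective (trans (sym (psLabel-next {m = m} gx P upperx σ Pσ maxx))
                                                          (trans (same σ) (psLabel-next {m = m} gy P uppery σ Pσ maxy))))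
        agree-at : ∀ (t : Fin m) → side (hyp q σ (+ suc (toℕ t))) x ≡ side (hyp q σ (+ suc (toℕ t))) y
        agree-at t with side (hyp q σ (+ suc (toℕ t))) x in sx | side (hyp q σ (+ suc (toℕ t))) y in sy
        ... | true | true = refl
        ... | false | false = refl
        ... | true | false = ⊥-elim (<-irrefl (sym X≡Y)
                (levelsFrom-< P σ x y (λ q q′ Pq Pq′ d d∈ e → trans (agree q q′ Pq Pq′ d d∈) e) q Pq t sx sy))
        ... | false | true = ⊥-elim (<-irrefl X≡Y
                (levelsFrom-< P σ y x (λ q q′ Pq Pq′ d d∈ e → trans (sym (agree q q′ Pq Pq′ d d∈)) e) q Pq t sy sx))

      agreeOn-insert : AgreeOn (insert P σ)
      agreeOn-insert q q′ Pq Pq′ d d∈ with insert-true P σ q Pq | insert-true P σ q′ Pq′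
      ... | inj₁ Pq | inj₁ Pq′ = agree q q′ Pq Pq′ d d∈
      ... | inj₁ Pq | inj₂ refl = old-new d d∈
        where
        old-new : ∀ d → InRange m d → side (hyp q σ d) x ≡ side (hyp q σ d) y
        old-new (+ zero) _ = trans (side-nonpos x (+ 0) (upperx q σ Pq Pσ) ℤP.≤-refl)
                                   (sym (side-nonpos y (+ 0) (uppery q σ Pq Pσ) ℤP.≤-refl))
        old-new +[1+ t ] d∈ = levels-agree q Pq t (InRange-pos⁻ d∈)
        old-new -[1+ t ] _ = trans (side-nonpos x -[1+ t ] (upperx q σ Pq Pσ) ℤ.-≤+)
                                   (sym (side-nonpos y -[1+ t ] (uppery q σ Pq Pσ) ℤ.-≤+))
      ... | inj₂ refl | inj₁ Pq′ = new-old d d∈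
        where
        q′≢σ : q′ ≢ σ
        q′≢σ refl = true≢false (trans (sym Pq′) Pσ)
        new-old : ∀ d → InRange m d → side (hyp σ q′ d) x ≡ side (hyp σ q′ d) y
        new-old (+ k) _ = trans (side-nonneg x (+ k) (upperx q′ σ Pq′ Pσ) (ℤ.+≤+ z≤n))
                                (sym (side-nonneg y (+ k) (uppery q′ σ Pq′ Pσ) (ℤ.+≤+ z≤n)))
        new-old -[1+ t ] d∈ = begin
          side (hyp σ q′ -[1+ t ]) x          ≡⟨ side-negate {x = x} (generic⇒separated {m = m} {x = x} gx q′ σ q′≢σ) t<m ⟩
          not (side (hyp q′ σ (+ suc t)) x)   ≡⟨ cong not (levels-agree q′ Pq′ t t<m) ⟩
          not (side (hyp q′ σ (+ suc t)) y)   ≡⟨ side-negate {x = y} (generic⇒separated {m = m} {x = y} gy q′ σ q′≢σ) t<m ⟨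
          side (hyp σ q′ -[1+ t ]) y          ∎
          where
          open ≡-Reasoning
          t<m : suc t ≤ m
          t<m = InRange-neg⁻ d∈
      ... | inj₂ refl | inj₂ refl = cong (λ w → does (ι d ℚP.<? w)) (trans (ℚP.+-inverseʳ (x σ)) (sym (ℚP.+-inverseʳ (y σ))))

    invariant-insert : card P < n → ∃ λ σ → P σ ≡ false × Invariant (insert P σ)
    invariant-insert |P|<n with upperSet-insert {m = m} gx P upperx |P|<n | upperSet-insert {m = m} gy P uppery |P|<n
    ... | σ , Pσ , upperx′ , maxx | σ′ , Pσ′ , uppery′ , maxy with next-coincide σ σ′ Pσ Pσ′ maxx maxy
    ...   | refl = σ , Pσ , upperx′ , uppery′ , agreeOn-insert σ Pσ maxx maxy

  invariant-ofSize : ∀ k → k ≤ n → ∃ λ P → Invariant P × card P ≡ k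
  invariant-ofSize zero _ = ∅ , (upperSet-∅ x , upperSet-∅ y , λ q q′ ()) , card-∅ {n}
  invariant-ofSize (suc k) k<n with invariant-ofSize k (≤-trans (n≤1+n k) k<n)
  ... | P , inv , |P|≡k with invariant-insert P inv (subst (_< n) (sym |P|≡k) k<n)
  ...   | σ , Pσ , inv′ = insert P σ , inv′ , trans (card-insert P σ Pσ) (cong suc |P|≡k)

  sameRegion : SameRegion n m x y
  sameRegion H H∈ with invariant-ofSize n ≤-refl | ∈-catalanHyps⁻ n m H∈
  ... | P , (_ , _ , agree) , |P|≡n | _ , a∈ = agree (hi H) (hj H) (full (hi H)) (full (hj H)) (ha H) a∈
    where
    full = card≡n⇒full P |P|≡n

-- Surjectivity

<⇒+1≤ : ∀ {i j} → i ℤ.< j → i ℤ.+ + 1 ℤ.≤ j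
<⇒+1≤ {i} i<j = subst (ℤ._≤ _) (ℤP.+-comm (+ 1) i) (ℤP.i<j⇒suc[i]≤j i<j)

+1≤⇒< : ∀ {i j} → i ℤ.+ + 1 ℤ.≤ j → i ℤ.< j
+1≤⇒< {i} i+1≤j = ℤP.suc[i]≤j⇒i<j (subst (ℤ._≤ _) (ℤP.+-comm i (+ 1)) i+1≤j)

module _ where
  open ℤS.+-*-Solver

  +-cancelʳ-≤ℤ : ∀ {a b} c → a ℤ.+ c ℤ.≤ b ℤ.+ c → a ℤ.≤ b
  +-cancelʳ-≤ℤ {a} {b} c h = subst₂ ℤ._≤_ (cancel a) (cancel b) (ℤP.+-monoˡ-≤ (ℤ.- c) h)
    where
    cancel : ∀ x → x ℤ.+ c ℤ.- c ≡ x
    cancel x = solve 2 (λ x c → x :+ c :- c := x) refl x c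

  2*<2*+1⇒≤ : ∀ A B → + 2 ℤ.* A ℤ.< + 2 ℤ.* B ℤ.+ + 1 → A ℤ.≤ B
  2*<2*+1⇒≤ A B h = ℤP.*-cancelˡ-≤-pos A B (+ 2) (+-cancelʳ-≤ℤ (+ 1) (<⇒+1≤ h))

  ≤⇒2*<2*+1 : ∀ A B → A ℤ.≤ B → + 2 ℤ.* A ℤ.< + 2 ℤ.* B ℤ.+ + 1
  ≤⇒2*<2*+1 A B h = +1≤⇒< (ℤP.+-monoˡ-≤ (+ 1) (ℤP.*-monoˡ-≤-nonNeg (+ 2) h))

  2*≤2*+1⇒≤ : ∀ A B → + 2 ℤ.* A ℤ.≤ + 2 ℤ.* B ℤ.+ + 1 → A ℤ.≤ B
  2*≤2*+1⇒≤ A B h with ℤP.<-cmp B A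
  ... | tri< B<A _ _ = ⊥-elim (ℤP.<-irrefl refl (ℤP.<-≤-trans (+1≤⇒< ℤP.≤-refl) too-big))
    where
    too-big : + 2 ℤ.* B ℤ.+ + 1 ℤ.+ + 1 ℤ.≤ + 2 ℤ.* B ℤ.+ + 1
    too-big = ℤP.≤-trans (ℤP.≤-reflexive (solve 1 (λ B → con (+ 2) :* B :+ con (+ 1) :+ con (+ 1) := con (+ 2) :* (B :+ con (+ 1))) refl B))
                         (ℤP.≤-trans (ℤP.*-monoˡ-≤-nonNeg (+ 2) (<⇒+1≤ B<A)) h)
  ... | tri≈ _ B≡A _ = ℤP.≤-reflexive (sym B≡A)
  ... | tri> _ _ A<B = ℤP.<⇒≤ A<B

  odd≢even : ∀ A B → + 2 ℤ.* A ℤ.- + 1 ≢ + 2 ℤ.* B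
  odd≢even A B e = ℤP.<-irrefl refl (+1≤⇒< (ℤP.≤-trans (ℤP.≤-reflexive (sym 2A≡2B+1)) (ℤP.*-monoˡ-≤-nonNeg (+ 2) A≤B)))
    where
    2A≡2B+1 : + 2 ℤ.* A ≡ + 2 ℤ.* B ℤ.+ + 1
    2A≡2B+1 = trans (solve 1 (λ A → con (+ 2) :* A := (con (+ 2) :* A :- con (+ 1)) :+ con (+ 1)) refl A) (cong (ℤ._+ + 1) e)
    A≤B : A ℤ.≤ B
    A≤B = 2*≤2*+1⇒≤ A B (ℤP.≤-reflexive 2A≡2B+1)

  crossing-point : ∀ u L j → L ℤ.- + suc j ℤ.≤ u → ¬ (L ℤ.- + j ℤ.≤ u) → u ≡ L ℤ.- + suc j
  crossing-point u L j below ¬above = ℤP.≤-antisym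
    (+-cancelʳ-≤ℤ (+ 1) (ℤP.≤-trans (<⇒+1≤ (ℤP.≰⇒> ¬above))
      (ℤP.≤-reflexive (trans (solve 2 (λ L j → L :- j := (L :- (con (+ 1) :+ j)) :+ con (+ 1)) refl L (+ j))
                             (cong (λ w → L ℤ.- w ℤ.+ + 1) (sym (ℤP.pos-+ 1 j)))))))
    below

  ≤-sub-swap : ∀ a b c → a ℤ.≤ b ℤ.- c → c ℤ.≤ b ℤ.- a
  ≤-sub-swap a b c h = subst₂ ℤ._≤_ (solve 2 (λ a c → a :+ (c :- a) := c) refl a c)
                                    (solve 3 (λ a b c → b :- c :+ (c :- a) := b :- a) refl a b c) (ℤP.+-monoˡ-≤ (c ℤ.- a) h)

  module Doubling (K : ℕ) where
    private
      κ : ℤ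
      κ = + K
      α2κ : ∀ α → α ℤ.* (+ 2 ℤ.* κ) ≡ + 2 ℤ.* (α ℤ.* κ)
      α2κ α = solve 2 (λ α K → α :* (con (+ 2) :* K) := con (+ 2) :* (α :* K)) refl α κ
      odd-gap : ∀ X v → + 2 ℤ.* X ℤ.- (+ 2 ℤ.* v ℤ.- + 1) ≡ + 2 ℤ.* (X ℤ.- v) ℤ.+ + 1
      odd-gap X v = solve 2 (λ X v → con (+ 2) :* X :- (con (+ 2) :* v :- con (+ 1)) := con (+ 2) :* (X :- v) :+ con (+ 1)) refl X v
      even-gap : ∀ a b → + 2 ℤ.* a ℤ.- + 2 ℤ.* b ≡ + 2 ℤ.* (a ℤ.- b)
      even-gap a b = solve 2 (λ a b → con (+ 2) :* a :- con (+ 2) :* b := con (+ 2) :* (a :- b)) refl a b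

    level-new⁻ : ∀ α X v → α ℤ.* (+ 2 ℤ.* κ) ℤ.< + 2 ℤ.* X ℤ.- (+ 2 ℤ.* v ℤ.- + 1) → α ℤ.* κ ℤ.≤ X ℤ.- v
    level-new⁻ α X v h = 2*<2*+1⇒≤ (α ℤ.* κ) (X ℤ.- v) (subst₂ ℤ._<_ (α2κ α) (odd-gap X v) h)

    level-new⁺ : ∀ α X v → α ℤ.* κ ℤ.≤ X ℤ.- v → α ℤ.* (+ 2 ℤ.* κ) ℤ.< + 2 ℤ.* X ℤ.- (+ 2 ℤ.* v ℤ.- + 1)
    level-new⁺ α X v h = subst₂ ℤ._<_ (sym (α2κ α)) (sym (odd-gap X v)) (≤⇒2*<2*+1 (α ℤ.* κ) (X ℤ.- v) h)

    level-new-≤⁻ : ∀ α X v → α ℤ.* (+ 2 ℤ.* κ) ℤ.≤ + 2 ℤ.* X ℤ.- (+ 2 ℤ.* v ℤ.- + 1) → α ℤ.* κ ℤ.≤ X ℤ.- v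
    level-new-≤⁻ α X v h = 2*≤2*+1⇒≤ (α ℤ.* κ) (X ℤ.- v) (subst₂ ℤ._≤_ (α2κ α) (odd-gap X v) h)

    level-doubled⁻ : ∀ α a b → α ℤ.* (+ 2 ℤ.* κ) ℤ.< + 2 ℤ.* a ℤ.- + 2 ℤ.* b → α ℤ.* κ ℤ.< a ℤ.- b
    level-doubled⁻ α a b h = ℤP.*-cancelˡ-<-nonNeg (+ 2) (subst₂ ℤ._<_ (α2κ α) (even-gap a b) h)

    level-doubled⁺ : ∀ α a b → α ℤ.* κ ℤ.< a ℤ.- b → α ℤ.* (+ 2 ℤ.* κ) ℤ.< + 2 ℤ.* a ℤ.- + 2 ℤ.* b
    level-doubled⁺ α a b h = subst₂ ℤ._<_ (sym (α2κ α)) (sym (even-gap a b)) (ℤP.*-monoˡ-<-pos (+ 2) h)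

    multiple-doubled⁻ : ∀ z a b → + 2 ℤ.* a ℤ.- + 2 ℤ.* b ≡ z ℤ.* (+ 2 ℤ.* κ) → a ℤ.- b ≡ z ℤ.* κ
    multiple-doubled⁻ z a b e = ℤP.*-cancelˡ-≡ (+ 2) (a ℤ.- b) (z ℤ.* κ) (trans (sym (even-gap a b)) (trans e (α2κ z)))

    new-not-multiple : ∀ v X z → (+ 2 ℤ.* v ℤ.- + 1) ℤ.- + 2 ℤ.* X ≢ z ℤ.* (+ 2 ℤ.* κ)
    new-not-multiple v X z e = odd≢even (v ℤ.- X) (z ℤ.* κ)
      (trans (solve 2 (λ v X → con (+ 2) :* (v :- X) :- con (+ 1) := (con (+ 2) :* v :- con (+ 1)) :- con (+ 2) :* X) refl v X)
             (trans e (α2κ z)))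

    new-not-multiple′ : ∀ v X z → + 2 ℤ.* X ℤ.- (+ 2 ℤ.* v ℤ.- + 1) ≢ z ℤ.* (+ 2 ℤ.* κ)
    new-not-multiple′ v X z e = new-not-multiple v X (ℤ.- z)
      (trans (solve 2 (λ v X → (con (+ 2) :* v :- con (+ 1)) :- con (+ 2) :* X := :- (con (+ 2) :* X :- (con (+ 2) :* v :- con (+ 1)))) refl v X)
             (trans (cong ℤ.-_ e) (solve 2 (λ z K → :- (z :* (con (+ 2) :* K)) := (:- z) :* (con (+ 2) :* K)) refl z κ)))

    new-below : ∀ v L X → v ℤ.≤ L → L ℤ.≤ X → + 2 ℤ.* v ℤ.- + 1 ℤ.< + 2 ℤ.* X
    new-below v L X v≤L L≤X = ℤP.<-≤-trans 2v-1<2v (ℤP.*-monoˡ-≤-nonNeg (+ 2) (ℤP.≤-trans v≤L L≤X))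
      where
      2v-1<2v : + 2 ℤ.* v ℤ.- + 1 ℤ.< + 2 ℤ.* v
      2v-1<2v = subst (+ 2 ℤ.* v ℤ.- + 1 ℤ.<_) (ℤP.+-identityʳ (+ 2 ℤ.* v)) (ℤP.+-monoʳ-< (+ 2 ℤ.* v) (ℤ.-<+ {0} {0}))

    level-far-below : ∀ α L X M → α ℤ.≤ + M → L ℤ.≤ X → α ℤ.* κ ℤ.≤ X ℤ.- (L ℤ.- + (M * K))
    level-far-below α L X M α≤M L≤X = ℤP.≤-trans (ℤP.*-monoʳ-≤-nonNeg κ α≤M)
      (ℤP.≤-trans (ℤP.≤-reflexive (trans (sym (ℤP.pos-* M K)) (sym (ℤP.+-identityˡ (+ (M * K))))))
        (ℤP.≤-trans (ℤP.+-monoˡ-≤ (+ (M * K)) (subst (ℤ._≤ X ℤ.- L) (ℤP.+-inverseʳ L) (ℤP.+-monoˡ-≤ (ℤ.- L) L≤X)))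
          (ℤP.≤-reflexive (solve 3 (λ X L MK → X :- L :+ MK := X :- (L :- MK)) refl X L (+ (M * K))))))

    no-self-level : ∀ α y → + 1 ℤ.≤ α → 1 ≤ K → ¬ (α ℤ.* (+ 2 ℤ.* κ) ℤ.≤ y ℤ.- y)
    no-self-level α y 1≤α 1≤K h = ℤP.<-irrefl refl (ℤP.<-≤-trans positive (ℤP.≤-trans h (ℤP.≤-reflexive (ℤP.+-inverseʳ y))))
      where
      positive : + 0 ℤ.< α ℤ.* (+ 2 ℤ.* κ)
      positive rewrite sym (ℤP.pos-* 2 K) =
        ℤP.<-≤-trans (ℤ.+<+ (s≤s z≤n)) (ℤP.≤-trans (ℤ.+≤+ (≤-trans 1≤K (m≤m+n K (K + 0))))
          (ℤP.≤-trans (ℤP.≤-reflexive (sym (ℤP.*-identityˡ (+ (2 * K))))) (ℤP.*-monoʳ-≤-nonNeg (+ (2 * K)) 1≤α)))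

above-remove : ∀ {n} (P : Fin n → Bool) h s → P h ≡ true → s F.< h → above P s ≡ suc (above (remove P h) s)
above-remove P h s Ph s<h =
  trans (sum-remove P h Ph (λ q → 𝟙 (does (s F.<? q))))
        (trans (cong (_+_ (above (remove P h) s)) (cong 𝟙 (dec-true (s F.<? h) s<h))) (+-comm _ 1))

centre-escape : ∀ {n} (a : Fin n → ℕ) (X : List (Fin n)) p (P : Fin n → Bool) → Descending X →
  (∀ t → a (lookup X t) ≤ p + suc (toℕ t)) → card P < length X →
  ∃ λ t → P (lookup X t) ≡ false × a (lookup X t) ≤ p + suc (above P (lookup X t))
centre-escape a (h ∷ X) p P L bounds |P|<|X| with P h in Ph
... | false = zero , Ph , ≤-trans (bounds zero) (+-monoʳ-≤ p (s≤s z≤n))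
... | true with centre-escape a X (suc p) (remove P h) (Lk.tail L) bounds′ |P′|<|X|
  where
  bounds′ : ∀ t → a (lookup X t) ≤ suc p + suc (toℕ t)
  bounds′ t = ≤-trans (bounds (suc t)) (≤-reflexive (+-suc p (suc (toℕ t))))
  |P′|<|X| : card (remove P h) < length X
  |P′|<|X| = ≤-pred (subst (_< suc (length X)) (card-remove P h Ph) |P|<|X|)
... | t , P′s , a≤ = suc t , Ps , ≤-trans a≤ (≤-reflexive (trans (sym (+-suc p _)) (cong (λ k → p + suc k) (sym (above-remove P h s Ph s<h)))))
  where
  s = lookup X t
  s<h : s F.< h
  s<h = All.lookup (descending⇒below-head L) (MP.∈-lookup t)
  Ps : P s ≡ false
  Ps = remove-false P h s P′s (λ s≡h → <-irrefl (cong toℕ s≡h) s<h)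

lex-key : ∀ n b₁ b₂ t₁ t₂ → t₁ < n → t₂ < n → b₁ * n + t₁ ≤ b₂ * n + t₂ → b₁ < b₂ ⊎ (b₁ ≡ b₂ × t₁ ≤ t₂)
lex-key n b₁ b₂ t₁ t₂ t₁<n t₂<n key≤ with <-cmp b₁ b₂
... | tri< b₁<b₂ _ _ = inj₁ b₁<b₂
... | tri≈ _ refl _ = inj₂ (refl , +-cancelˡ-≤ (b₁ * n) t₁ t₂ key≤)
... | tri> _ _ b₂<b₁ = ⊥-elim (<-irrefl refl (begin-strict
  b₂ * n + t₂    <⟨ +-monoʳ-< (b₂ * n) t₂<n ⟩
  b₂ * n + n     ≡⟨ +-comm (b₂ * n) n ⟩
  suc b₂ * n     ≤⟨ *-monoˡ-≤ n b₂<b₁ ⟩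
  b₁ * n         ≤⟨ m≤m+n (b₁ * n) t₁ ⟩
  b₁ * n + t₁    ≤⟨ key≤ ⟩
  b₂ * n + t₂    ∎))
  where open ≤-Reasoning

discrete-ivt : ∀ (f : ℕ → ℕ) c → f 0 ≤ c → ∀ J → c ≤ f J → (∀ j → f (suc j) ≤ suc (f j)) → ∃ λ j → f j ≡ c
discrete-ivt f c f0≤c zero c≤fJ _ = 0 , ≤-antisym f0≤c c≤fJ
discrete-ivt f c f0≤c (suc J) c≤fJ step with c ≤? f J
... | yes c≤fJ′ = discrete-ivt f c f0≤c J c≤fJ′ step
... | no c≰fJ′ = suc J , ≤-antisym (≤-trans (step J) (≰⇒> c≰fJ′)) c≤fJ

module _ {n : ℕ} (m K : ℕ) (X : Fin n → ℤ) where

  levelsℤ levelsℤ≤ : Fin n → ℤ → ℕ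
  levelsℤ q v = sumTo m (λ t → 𝟙 (does (+ suc t ℤ.* + K ℤ.<? X q ℤ.- v)))
  levelsℤ≤ q v = sumTo m (λ t → 𝟙 (does (+ suc t ℤ.* + K ℤ.≤? X q ℤ.- v)))

  contributionℤ : Fin n → Fin n → ℕ
  contributionℤ q s = if does (X s ℤ.<? X q) then 𝟙 (does (s F.<? q)) + levelsℤ q (X s) else 0

module _ {n m : ℕ} (a : Fin n → ℕ) (catalan : IsCatalanFn n m a) where

  -- The placed coordinates are X q / (k + 1); budget bounds the levels that a new coordinate placed
  -- at the floor L would see.
  record Partial (r : ℕ) : Set where
    field
      placed : Fin n → Bool
      X : Fin n → ℤ
      k : ℕ
      L : ℤ
      budget : ℕ
      card-placed : card placed ≡ r
      above-floor : ∀ q → placed q ≡ true → L ℤ.≤ X q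
      separated : ∀ q q′ → placed q ≡ true → placed q′ ≡ true → q ≢ q′ → ∀ z → X q ℤ.- X q′ ≢ z ℤ.* + suc k
      floor-levels : sum (λ q → 𝟙 (placed q) * levelsℤ≤ m (suc k) X q L) ≤ budget
      unplaced-label : ∀ s → placed s ≡ false → suc (above placed s + budget) ≤ a s
      placed-label : ∀ s → placed s ≡ true → a s ≡ suc (sum (λ q → 𝟙 (placed q) * contributionℤ m (suc k) X q s))

  partial₀ : Partial 0
  partial₀ = record
    { placed = ∅ ; X = λ _ → + 0 ; k = 0 ; L = + 0 ; budget = 0
    ; card-placed = card-∅ {n}
    ; above-floor = λ q ()
    ; separated = λ q q′ ()
    ; floor-levels = ≤-reflexive (sum-zero {n} (λ _ → refl))
    ; unplaced-label = λ s _ → subst (λ z → suc (z + 0) ≤ a s) (sym (sum-zero {n} (λ _ → refl))) (proj₁ catalan s)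
    ; placed-label = λ s ()
    }

module Extend {n m : ℕ} (a : Fin n → ℕ) (catalan : IsCatalanFn n m a) {r : ℕ} (r<n : r < n) (st : Partial a catalan r) where
  open Partial st

  K : ℕ
  K = suc k

  slack : Fin n → ℕ
  slack s = a s ∸ suc (above placed s)

  a≡slack : ∀ s → placed s ≡ false → a s ≡ suc (above placed s + slack s)
  a≡slack s Ps = trans (sym (m∸n+n≡m 1+above≤a)) (trans (+-suc (slack s) (above placed s)) (cong suc (+-comm (slack s) (above placed s))))
    where
    1+above≤a : suc (above placed s) ≤ a s
    1+above≤a = ≤-trans (s≤s (m≤m+n (above placed s) budget)) (unplaced-label s Ps)

  -- Lexicographic order on (slack, index).
  key : Fin n → ℕ
  key s = slack s * n + toℕ s

  opaque
    next : ∃ λ σ → placed σ ≡ false × (∀ s → placed s ≡ false → slack σ + 𝟙 (does (s F.<? σ)) ≤ slack s)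
    next with argmax (Flip.totalPreorder ≤-totalPreorder) key (λ s → not (placed s))
    ... | inj₁ none = ⊥-elim (<-irrefl (trans (sym card-placed) (card-full placed (λ s → BP.not-injective (none s)))) r<n)
    ... | inj₂ (σ , Pσ , min) = σ , BP.not-injective Pσ ,
          λ s Ps → lex⇒≤ s (lex-key n (slack σ) (slack s) (toℕ σ) (toℕ s) (FP.toℕ<n σ) (FP.toℕ<n s) (min s (cong not Ps)))
      where
      lex⇒≤ : ∀ s → slack σ < slack s ⊎ (slack σ ≡ slack s × toℕ σ ≤ toℕ s) → slack σ + 𝟙 (does (s F.<? σ)) ≤ slack s
      lex⇒≤ s (inj₁ lt) = ≤-trans (+-monoʳ-≤ (slack σ) (𝟙≤1 _)) (≤-trans (≤-reflexive (+-comm (slack σ) 1)) lt)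
      lex⇒≤ s (inj₂ (eq , σ≤s)) rewrite dec-false (s F.<? σ) (≤⇒≯ σ≤s) = ≤-reflexive (trans (+-identityʳ (slack σ)) eq)

  σ : Fin n
  σ = proj₁ next

  Pσ : placed σ ≡ false
  Pσ = proj₁ (proj₂ next)

  σ-minimal : ∀ s → placed s ≡ false → slack σ + 𝟙 (does (s F.<? σ)) ≤ slack s
  σ-minimal = proj₂ (proj₂ next)

  budget≤slack : budget ≤ slack σ
  budget≤slack = +-cancelˡ-≤ (above placed σ) budget (slack σ)
    (≤-pred (≤-trans (unplaced-label σ Pσ) (≤-reflexive (a≡slack σ Pσ))))

  slack≤rm : slack σ ≤ r * m
  slack≤rm with proj₂ catalan (suc r) (s≤s z≤n) r<n
  ... | z , ((C , (C-descending , C-bounds) , |C|≡z) , _) , r+1≤z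
    with centre-escape a C (r * m) placed C-descending C-bounds (subst (_< length C) (sym card-placed) (≤-trans r+1≤z (≤-reflexive (sym |C|≡z))))
  ...   | t , Ps , a≤ = ≤-trans (m≤m+n (slack σ) _) (≤-trans (σ-minimal s Ps)
                          (≤-trans (∸-monoˡ-≤ (suc (above placed s)) a≤) (≤-reflexive (m+n∸n≡m (r * m) (suc (above placed s))))))
    where s = lookup C t

  κ : ℤ
  κ = + K

  α : Fin m → ℤ
  α t = + suc (toℕ t)

  levelsAt : ℕ → ℕ
  levelsAt j = sum (λ q → 𝟙 (placed q) * levelsℤ≤ m K X q (L ℤ.- + j))

  levelsAt-0 : levelsAt 0 ≤ slack σ
  levelsAt-0 = ≤-trans (≤-reflexive (sum-cong-≗ (λ q → cong (λ w → 𝟙 (placed q) * levelsℤ≤ m K X q w) (ℤP.+-identityʳ L))))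
                       (≤-trans floor-levels budget≤slack)

  levelsAt-deep : slack σ ≤ levelsAt (m * K)
  levelsAt-deep = ≤-trans slack≤rm (≤-reflexive (sym (trans (sum-cong-≗ all-levels)
                    (trans (sym (*-distribˡ-sum m (λ q → 𝟙 (placed q)))) (trans (cong (m *_) card-placed) (*-comm m r))))))
    where
    all-levels : ∀ q → 𝟙 (placed q) * levelsℤ≤ m K X q (L ℤ.- + (m * K)) ≡ m * 𝟙 (placed q)
    all-levels q with placed q in Pq
    ... | false = sym (*-zeroʳ m)
    ... | true = trans (+-identityʳ _) (trans (trans (sum-cong-≗ {m} (λ t → cong 𝟙 (dec-true (α t ℤ.* κ ℤ.≤? X q ℤ.- (L ℤ.- + (m * K)))
                   (Doubling.level-far-below K (α t) L (X q) m (ℤ.+≤+ (FP.toℕ<n t)) (above-floor q Pq)))))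
                   (trans (sum-const {m} 1) (*-identityʳ m))) (sym (*-identityʳ m)))

  hitsAt : ℕ → Fin n → Fin m → ℕ
  hitsAt j q t = 𝟙 (does (X q ℤ.- α t ℤ.* κ ℤ.≟ L ℤ.- + suc j))

  hitsAt-≡ : ∀ {j q t} → 1 ≤ hitsAt j q t → X q ℤ.- α t ℤ.* κ ≡ L ℤ.- + suc j
  hitsAt-≡ {j} {q} {t} with X q ℤ.- α t ℤ.* κ ℤ.≟ L ℤ.- + suc j
  ... | yes e = λ _ → e

  levelsℤ≤-step : ∀ j q → levelsℤ≤ m K X q (L ℤ.- + suc j) ≤ levelsℤ≤ m K X q (L ℤ.- + j) + sum (hitsAt j q)
  levelsℤ≤-step j q = ≤-trans (sum-mono-≤ {m} termwise)
                              (≤-reflexive (∑-distrib-+ (λ t → 𝟙 (does (α t ℤ.* κ ℤ.≤? X q ℤ.- (L ℤ.- + j)))) (hitsAt j q)))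
    where
    termwise : ∀ t → 𝟙 (does (α t ℤ.* κ ℤ.≤? X q ℤ.- (L ℤ.- + suc j)))
                       ≤ 𝟙 (does (α t ℤ.* κ ℤ.≤? X q ℤ.- (L ℤ.- + j))) + hitsAt j q t
    termwise t with α t ℤ.* κ ℤ.≤? X q ℤ.- (L ℤ.- + suc j)
    ... | no _ = z≤n
    ... | yes deep with α t ℤ.* κ ℤ.≤? X q ℤ.- (L ℤ.- + j)
    ...   | yes _ = s≤s z≤n
    ...   | no ¬shallow = ≤-reflexive (sym (cong 𝟙 (dec-true (X q ℤ.- α t ℤ.* κ ℤ.≟ L ℤ.- + suc j)
                            (crossing-point (X q ℤ.- α t ℤ.* κ) L j (≤-sub-swap (α t ℤ.* κ) (X q) (L ℤ.- + suc j) deep)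
                               (¬shallow ∘ ≤-sub-swap (L ℤ.- + j) (X q) (α t ℤ.* κ))))))

  same-level : ∀ u u′ A A′ V → u ℤ.- A ℤ.* κ ≡ V → u′ ℤ.- A′ ℤ.* κ ≡ V → u ℤ.- u′ ≡ (A ℤ.- A′) ℤ.* κ
  same-level u u′ A A′ V e e′ = begin
    u ℤ.- u′                                                    ≡⟨ solve 5 (λ u u′ A A′ K → u :- u′ := ((u :- A :* K) :- (u′ :- A′ :* K)) :+ (A :- A′) :* K) refl u u′ A A′ κ ⟩
    ((u ℤ.- A ℤ.* κ) ℤ.- (u′ ℤ.- A′ ℤ.* κ)) ℤ.+ (A ℤ.- A′) ℤ.* κ ≡⟨ cong₂ (λ p p′ → (p ℤ.- p′) ℤ.+ (A ℤ.- A′) ℤ.* κ) e e′ ⟩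
    (V ℤ.- V) ℤ.+ (A ℤ.- A′) ℤ.* κ                               ≡⟨ cong (ℤ._+ (A ℤ.- A′) ℤ.* κ) (ℤP.+-inverseʳ V) ⟩
    + 0 ℤ.+ (A ℤ.- A′) ℤ.* κ                                     ≡⟨ ℤP.+-identityˡ _ ⟩
    (A ℤ.- A′) ℤ.* κ                                             ∎
    where
    open ≡-Reasoning
    open ℤS.+-*-Solver

  κ-cancel : ∀ A A′ → (A ℤ.- A′) ℤ.* κ ≡ + 0 → A ≡ A′
  κ-cancel A A′ e with ℤP.i*j≡0⇒i≡0∨j≡0 (A ℤ.- A′) e
  ... | inj₁ A-A′≡0 = ℤP.i-j≡0⇒i≡j A A′ A-A′≡0

  one-hit-per-point : ∀ j q → sum (hitsAt j q) ≤ 1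
  one-hit-per-point j q = sum-≤1 {m} (λ t → 𝟙≤1 _) unique
    where
    unique : ∀ t t′ → 1 ≤ hitsAt j q t → 1 ≤ hitsAt j q t′ → t ≡ t′
    unique t t′ h h′ = FP.toℕ-injective (suc-injective (ℤP.+-injective (κ-cancel (α t) (α t′)
      (trans (sym (same-level (X q) (X q) (α t) (α t′) (L ℤ.- + suc j) (hitsAt-≡ {j} {q} {t} h) (hitsAt-≡ {j} {q} {t′} h′))) (ℤP.+-inverseʳ (X q))))))

  one-hit-per-level : ∀ j → sum (λ q → 𝟙 (placed q) * sum (hitsAt j q)) ≤ 1
  one-hit-per-level j = sum-≤1 bounded unique
    where
    bounded : ∀ q → 𝟙 (placed q) * sum (hitsAt j q) ≤ 1
    bounded q with placed q
    ... | true = ≤-trans (≤-reflexive (+-identityʳ _)) (one-hit-per-point j q)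
    ... | false = z≤n
    hit-placed : ∀ q → 1 ≤ 𝟙 (placed q) * sum (hitsAt j q) → placed q ≡ true × 1 ≤ sum (hitsAt j q)
    hit-placed q h with placed q
    ... | true = refl , ≤-trans h (≤-reflexive (+-identityʳ _))
    ... | false = ⊥-elim (1+n≰n h)
    unique : ∀ q q′ → 1 ≤ 𝟙 (placed q) * sum (hitsAt j q) → 1 ≤ 𝟙 (placed q′) * sum (hitsAt j q′) → q ≡ q′
    unique q q′ h h′ with hit-placed q h | hit-placed q′ h′
    ... | Pq , hq | Pq′ , hq′ with sum-positive (hitsAt j q) hq | sum-positive (hitsAt j q′) hq′
    ...   | t , ht | t′ , ht′ with q F.≟ q′
    ...     | yes q≡q′ = q≡q′
    ...     | no q≢q′ = ⊥-elim (separated q q′ Pq Pq′ q≢q′ (α t ℤ.- α t′)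
                 (same-level (X q) (X q′) (α t) (α t′) (L ℤ.- + suc j) (hitsAt-≡ {j} {q} {t} ht) (hitsAt-≡ {j} {q′} {t′} ht′)))

  levelsAt-step : ∀ j → levelsAt (suc j) ≤ suc (levelsAt j)
  levelsAt-step j = begin
    levelsAt (suc j)
      ≤⟨ sum-mono-≤ (λ q → ≤-trans (*-monoʳ-≤ (𝟙 (placed q)) (levelsℤ≤-step j q)) (≤-reflexive (*-distribˡ-+ (𝟙 (placed q)) _ _))) ⟩
    sum (λ q → 𝟙 (placed q) * levelsℤ≤ m K X q (L ℤ.- + j) + 𝟙 (placed q) * sum (hitsAt j q))
      ≡⟨ ∑-distrib-+ (λ q → 𝟙 (placed q) * levelsℤ≤ m K X q (L ℤ.- + j)) (λ q → 𝟙 (placed q) * sum (hitsAt j q)) ⟩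
    levelsAt j + sum (λ q → 𝟙 (placed q) * sum (hitsAt j q))
      ≤⟨ +-monoʳ-≤ (levelsAt j) (one-hit-per-level j) ⟩
    levelsAt j + 1
      ≡⟨ +-comm (levelsAt j) 1 ⟩
    suc (levelsAt j) ∎
    where open ≤-Reasoning

  -- Lowering the new coordinate by one unit adds at most one level, as the placed ones are separated.
  opaque
    depth : ∃ λ j → levelsAt j ≡ slack σ
    depth = discrete-ivt levelsAt (slack σ) levelsAt-0 (m * K) levelsAt-deep levelsAt-step

  j : ℕ
  j = proj₁ depth

  v y : ℤ
  v = L ℤ.- + j
  y = + 2 ℤ.* v ℤ.- + 1

  placed′ : Fin n → Bool
  placed′ = insert placed σ

  K′ : ℕ
  K′ = 2 * K

  -- Doubling keeps all old comparisons, and the odd new coordinate lies on no hyperplane with an old one.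
  X′ : Fin n → ℤ
  X′ q = if does (q F.≟ σ) then y else + 2 ℤ.* X q

  X′σ : X′ σ ≡ y
  X′σ rewrite dec-true (σ F.≟ σ) refl = refl

  X′-old : ∀ {q} → placed q ≡ true → X′ q ≡ + 2 ℤ.* X q
  X′-old {q} Pq rewrite dec-false (q F.≟ σ) (λ { refl → true≢false (trans (sym Pq) Pσ) }) = refl

  κ′ : + K′ ≡ + 2 ℤ.* κ
  κ′ = ℤP.pos-* 2 K

  y-below : ∀ {q} → placed q ≡ true → y ℤ.< X′ q
  y-below {q} Pq = subst (y ℤ.<_) (sym (X′-old Pq))
    (Doubling.new-below K v L (X q) (subst (v ℤ.≤_) (ℤP.+-identityʳ L) (ℤP.+-monoʳ-≤ L (ℤP.neg-mono-≤ (ℤ.+≤+ (z≤n {j}))))) (above-floor q Pq))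

  level-new : ∀ q → placed q ≡ true → ∀ t → α t ℤ.* + K′ ℤ.< X′ q ℤ.- y ⇔ α t ℤ.* κ ℤ.≤ X q ℤ.- v
  level-new q Pq t = mk⇔
    (λ h → Doubling.level-new⁻ K (α t) (X q) v (subst₂ (λ k w → α t ℤ.* k ℤ.< w) κ′ (cong (ℤ._- y) (X′-old Pq)) h))
    (λ h → subst₂ (λ k w → α t ℤ.* k ℤ.< w) (sym κ′) (sym (cong (ℤ._- y) (X′-old Pq))) (Doubling.level-new⁺ K (α t) (X q) v h))

  levelsℤ-new : ∀ q → placed q ≡ true → levelsℤ m K′ X′ q y ≡ levelsℤ≤ m K X q v
  levelsℤ-new q Pq = sum-cong-≗ {m} (λ t → cong 𝟙 (does-⇔ (Equivalence.to (level-new q Pq t)) (Equivalence.from (level-new q Pq t))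
                       (α t ℤ.* + K′ ℤ.<? X′ q ℤ.- y) (α t ℤ.* κ ℤ.≤? X q ℤ.- v)))

  levelsℤ≤-new : ∀ q → placed q ≡ true → levelsℤ≤ m K′ X′ q y ≡ levelsℤ≤ m K X q v
  levelsℤ≤-new q Pq = sum-cong-≗ {m} (λ t → cong 𝟙 (does-⇔
    (λ h → Doubling.level-new-≤⁻ K (α t) (X q) v (subst₂ (λ k w → α t ℤ.* k ℤ.≤ w) κ′ (cong (ℤ._- y) (X′-old Pq)) h))
    (λ h → ℤP.<⇒≤ (Equivalence.from (level-new q Pq t) h))
    (α t ℤ.* + K′ ℤ.≤? X′ q ℤ.- y) (α t ℤ.* κ ℤ.≤? X q ℤ.- v)))

  levelsℤ≤-self : levelsℤ≤ m K′ X′ σ y ≡ 0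
  levelsℤ≤-self = sum-zero {m} (λ t → cong 𝟙 (dec-false (α t ℤ.* + K′ ℤ.≤? X′ σ ℤ.- y)
    (λ h → Doubling.no-self-level K (α t) y (ℤ.+≤+ (s≤s z≤n)) (s≤s z≤n) (subst₂ (λ k w → α t ℤ.* k ℤ.≤ w) κ′ (cong (ℤ._- y) X′σ) h))))

  contributionℤ-old : ∀ {q s} → placed q ≡ true → placed s ≡ true → contributionℤ m K′ X′ q s ≡ contributionℤ m K X q s
  contributionℤ-old {q} {s} Pq Ps = cong₂ (λ b w → if b then 𝟙 (does (s F.<? q)) + w else 0)
    (does-⇔ (λ h → ℤP.*-cancelˡ-<-nonNeg (+ 2) (subst₂ ℤ._<_ (X′-old Ps) (X′-old Pq) h))
            (λ h → subst₂ ℤ._<_ (sym (X′-old Ps)) (sym (X′-old Pq)) (ℤP.*-monoˡ-<-pos (+ 2) h))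
            (X′ s ℤ.<? X′ q) (X s ℤ.<? X q))
    (sum-cong-≗ {m} (λ t → cong 𝟙 (does-⇔
      (λ h → Doubling.level-doubled⁻ K (α t) (X q) (X s) (subst₂ (λ k w → α t ℤ.* k ℤ.< w) κ′ gap h))
      (λ h → subst₂ (λ k w → α t ℤ.* k ℤ.< w) (sym κ′) (sym gap) (Doubling.level-doubled⁺ K (α t) (X q) (X s) h))
      (α t ℤ.* + K′ ℤ.<? X′ q ℤ.- X′ s) (α t ℤ.* κ ℤ.<? X q ℤ.- X s))))
    where
    gap : X′ q ℤ.- X′ s ≡ + 2 ℤ.* X q ℤ.- + 2 ℤ.* X s
    gap = cong₂ ℤ._-_ (X′-old Pq) (X′-old Ps)

  contributionℤ-new-old : ∀ {s} → placed s ≡ true → contributionℤ m K′ X′ σ s ≡ 0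
  contributionℤ-new-old {s} Ps rewrite dec-false (X′ s ℤ.<? X′ σ) (λ h → ℤP.<-asym (y-below Ps) (subst (X′ s ℤ.<_) X′σ h)) = refl

  contributionℤ-old-new : ∀ {q} → placed q ≡ true → contributionℤ m K′ X′ q σ ≡ 𝟙 (does (σ F.<? q)) + levelsℤ≤ m K X q v
  contributionℤ-old-new {q} Pq rewrite dec-true (X′ σ ℤ.<? X′ q) (subst (ℤ._< X′ q) (sym X′σ) (y-below Pq)) =
    cong (_+_ (𝟙 (does (σ F.<? q)))) (trans (cong (levelsℤ m K′ X′ q) X′σ) (levelsℤ-new q Pq))

  contributionℤ-self : contributionℤ m K′ X′ σ σ ≡ 0
  contributionℤ-self rewrite dec-false (X′ σ ℤ.<? X′ σ) (ℤP.<-irrefl refl) = refl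

  above-floor′ : ∀ q → placed′ q ≡ true → y ℤ.≤ X′ q
  above-floor′ q P′q with insert-true placed σ q P′q
  ... | inj₁ Pq = ℤP.<⇒≤ (y-below Pq)
  ... | inj₂ refl = ℤP.≤-reflexive (sym X′σ)

  separated′ : ∀ q q′ → placed′ q ≡ true → placed′ q′ ≡ true → q ≢ q′ → ∀ z → X′ q ℤ.- X′ q′ ≢ z ℤ.* + K′
  separated′ q q′ P′q P′q′ q≢q′ z e with insert-true placed σ q P′q | insert-true placed σ q′ P′q′
  ... | inj₁ Pq | inj₁ Pq′ = separated q q′ Pq Pq′ q≢q′ z (Doubling.multiple-doubled⁻ K z (X q) (X q′)
          (trans (sym (cong₂ ℤ._-_ (X′-old Pq) (X′-old Pq′))) (trans e (cong (z ℤ.*_) κ′))))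
  ... | inj₁ Pq | inj₂ refl = Doubling.new-not-multiple′ K v (X q) z (trans (sym (cong₂ ℤ._-_ (X′-old Pq) X′σ)) (trans e (cong (z ℤ.*_) κ′)))
  ... | inj₂ refl | inj₁ Pq′ = Doubling.new-not-multiple K v (X q′) z (trans (sym (cong₂ ℤ._-_ X′σ (X′-old Pq′))) (trans e (cong (z ℤ.*_) κ′)))
  ... | inj₂ refl | inj₂ refl = q≢q′ refl

  floor-levels′ : sum (λ q → 𝟙 (placed′ q) * levelsℤ≤ m K′ X′ q y) ≤ slack σ
  floor-levels′ = ≤-reflexive (begin
    sum (λ q → 𝟙 (placed′ q) * levelsℤ≤ m K′ X′ q y)
      ≡⟨ sum-insert placed σ Pσ (λ q → levelsℤ≤ m K′ X′ q y) ⟩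
    sum (λ q → 𝟙 (placed q) * levelsℤ≤ m K′ X′ q y) + levelsℤ≤ m K′ X′ σ y
      ≡⟨ cong₂ _+_ (sum-restrict-cong placed levelsℤ≤-new) levelsℤ≤-self ⟩
    levelsAt j + 0
      ≡⟨ +-identityʳ _ ⟩
    levelsAt j
      ≡⟨ proj₂ depth ⟩
    slack σ ∎)
    where open ≡-Reasoning

  unplaced-label′ : ∀ s → placed′ s ≡ false → suc (above placed′ s + slack σ) ≤ a s
  unplaced-label′ s P′s with insert-false placed σ s P′s
  ... | Ps , _ = ≤-trans (s≤s (≤-trans (≤-reflexive regroup) (+-monoʳ-≤ (above placed s) (σ-minimal s Ps)))) (≤-reflexive (sym (a≡slack s Ps)))
    where
    regroup : above placed′ s + slack σ ≡ above placed s + (slack σ + 𝟙 (does (s F.<? σ)))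
    regroup = trans (cong (_+ slack σ) (sum-insert placed σ Pσ (λ q → 𝟙 (does (s F.<? q)))))
                    (trans (+-assoc (above placed s) _ (slack σ)) (cong (_+_ (above placed s)) (+-comm _ (slack σ))))

  placed-label′ : ∀ s → placed′ s ≡ true → a s ≡ suc (sum (λ q → 𝟙 (placed′ q) * contributionℤ m K′ X′ q s))
  placed-label′ s P′s with insert-true placed σ s P′s
  ... | inj₁ Ps = trans (placed-label s Ps) (cong suc (sym (begin
    sum (λ q → 𝟙 (placed′ q) * contributionℤ m K′ X′ q s)
      ≡⟨ sum-insert placed σ Pσ (λ q → contributionℤ m K′ X′ q s) ⟩
    sum (λ q → 𝟙 (placed q) * contributionℤ m K′ X′ q s) + contributionℤ m K′ X′ σ s
      ≡⟨ cong₂ _+_ (sum-restrict-cong placed (λ q Pq → contributionℤ-old Pq Ps)) (contributionℤ-new-old Ps) ⟩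
    sum (λ q → 𝟙 (placed q) * contributionℤ m K X q s) + 0
      ≡⟨ +-identityʳ _ ⟩
    sum (λ q → 𝟙 (placed q) * contributionℤ m K X q s) ∎)))
    where open ≡-Reasoning
  ... | inj₂ refl = trans (a≡slack σ Pσ) (cong suc (sym (begin
    sum (λ q → 𝟙 (placed′ q) * contributionℤ m K′ X′ q σ)
      ≡⟨ sum-insert placed σ Pσ (λ q → contributionℤ m K′ X′ q σ) ⟩
    sum (λ q → 𝟙 (placed q) * contributionℤ m K′ X′ q σ) + contributionℤ m K′ X′ σ σ
      ≡⟨ cong₂ _+_ (sum-restrict-cong placed (λ q Pq → contributionℤ-old-new Pq)) contributionℤ-self ⟩
    sum (λ q → 𝟙 (placed q) * (𝟙 (does (σ F.<? q)) + levelsℤ≤ m K X q v)) + 0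
      ≡⟨ +-identityʳ _ ⟩
    sum (λ q → 𝟙 (placed q) * (𝟙 (does (σ F.<? q)) + levelsℤ≤ m K X q v))
      ≡⟨ sum-cong-≗ (λ q → *-distribˡ-+ (𝟙 (placed q)) (𝟙 (does (σ F.<? q))) (levelsℤ≤ m K X q v)) ⟩
    sum (λ q → 𝟙 (placed q) * 𝟙 (does (σ F.<? q)) + 𝟙 (placed q) * levelsℤ≤ m K X q v)
      ≡⟨ ∑-distrib-+ (λ q → 𝟙 (placed q) * 𝟙 (does (σ F.<? q))) (λ q → 𝟙 (placed q) * levelsℤ≤ m K X q v) ⟩
    above placed σ + levelsAt j
      ≡⟨ cong (_+_ (above placed σ)) (proj₂ depth) ⟩
    above placed σ + slack σ ∎)))
    where open ≡-Reasoning

  extended : Partial a catalan (suc r)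
  extended = record
    { placed = placed′ ; X = X′ ; k = k + suc (k + 0) ; L = y ; budget = slack σ
    ; card-placed = trans (card-insert placed σ Pσ) (cong suc card-placed)
    ; above-floor = above-floor′
    ; separated = separated′
    ; floor-levels = floor-levels′
    ; unplaced-label = unplaced-label′
    ; placed-label = placed-label′
    }

module _ {n m : ℕ} (a : Fin n → ℕ) (catalan : IsCatalanFn n m a) where

  partial : ∀ r → r ≤ n → Partial a catalan r
  partial zero _ = partial₀ a catalan
  partial (suc r) r<n = Extend.extended a catalan r<n (partial r (≤-trans (n≤1+n r) r<n))

module Realise {n m : ℕ} (d : ℕ) (X : Fin n → ℤ)
               (separated : ∀ q q′ → q ≢ q′ → ∀ z → X q ℤ.- X q′ ≢ z ℤ.* + suc d) where

  x : Point n
  x q = X q ℚ./ suc d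

  x-gap : ∀ i j → x i ℚ.- x j ≡ (X i ℤ.- X j) ℚ./ suc d
  x-gap i j = /-sub (X i) (X j) d

  generic : Generic n m x
  generic H H∈ eq with ℤP.<-cmp (X (hi H) ℤ.- X (hj H)) (ha H ℤ.* + suc d)
  ... | tri< lt _ _ = ℚP.<-irrefl eq (subst (ℚ._< ι (ha H)) (sym (x-gap (hi H) (hj H))) (/<ι⁺ (ha H) _ d lt))
  ... | tri≈ _ e _ = separated (hi H) (hj H) (λ i≡j → <-irrefl (cong toℕ i≡j) (proj₁ (∈-catalanHyps⁻ n m H∈))) (ha H) e
  ... | tri> _ _ gt = ℚP.<-irrefl (sym eq) (subst (ι (ha H) ℚ.<_) (sym (x-gap (hi H) (hj H))) (ι</⁺ (ha H) _ d gt))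

  x-mono : ∀ {s k} → X s ℤ.< X k → x s ℚ.< x k
  x-mono {s} {k} Xs<Xk = sub-neg⇒< (subst (ℚ._< 0ℚ) (sym (x-gap s k)) (/<ι⁺ (+ 0) (X s ℤ.- X k) d
    (subst (X s ℤ.- X k ℤ.<_) (trans (ℤP.+-inverseʳ (X k)) (sym (ℤP.*-zeroˡ (+ suc d)))) (ℤP.+-monoˡ-< (ℤ.- X k) Xs<Xk))))

  contribution-realised : ∀ s k → contribution m x s k ≡ contributionℤ m (suc d) X s k
  contribution-realised s k with s F.≟ k
  ... | yes refl rewrite dec-false (X s ℤ.<? X s) (ℤP.<-irrefl refl) = contribution-self x m s
  ... | no s≢k with ℤP.<-cmp (X s) (X k)
  ...   | tri< Xs<Xk _ _ rewrite dec-false (X k ℤ.<? X s) (ℤP.<-asym Xs<Xk) = contribution-below x m s k (x-mono Xs<Xk)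
  ...   | tri≈ _ Xs≡Xk _ = ⊥-elim (separated s k s≢k (+ 0) (trans (cong (ℤ._-_ (X s)) (sym Xs≡Xk)) (trans (ℤP.+-inverseʳ (X s)) (sym (ℤP.*-zeroˡ (+ suc d))))))
  ...   | tri> _ _ Xk<Xs rewrite dec-true (X k ℤ.<? X s) Xk<Xs =
          trans (contribution-above x m s k (x-mono Xk<Xs) (generic⇒separated {n} {m} {x} generic s k s≢k))
                (cong (_+_ (𝟙 (does (k F.<? s)))) (sum-cong-≗ {m} level))
    where
    level : ∀ t → 𝟙 (side (hyp s k (+ suc (toℕ t))) x) ≡ 𝟙 (does (+ suc (toℕ t) ℤ.* + suc d ℤ.<? X s ℤ.- X k))
    level t = cong 𝟙 (does-⇔
      (λ h → ι</⁻ (+ suc (toℕ t)) (X s ℤ.- X k) d (subst (ι (+ suc (toℕ t)) ℚ.<_) (x-gap s k) h))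
      (λ h → subst (ι (+ suc (toℕ t)) ℚ.<_) (sym (x-gap s k)) (ι</⁺ (+ suc (toℕ t)) (X s ℤ.- X k) d h))
      (ι (+ suc (toℕ t)) ℚP.<? (x s ℚ.- x k)) (+ suc (toℕ t) ℤ.* + suc d ℤ.<? X s ℤ.- X k))

catalan⇒label : ∀ {n m} (a : Fin n → ℕ) → IsCatalanFn n m a → Σ (Point n) λ x → Generic n m x × (∀ k → psLabel n m x k ≡ a k)
catalan⇒label {n} {m} a catalan = x , generic , labels
  where
  open Partial (partial a catalan n ≤-refl)
  full : ∀ q → placed q ≡ true
  full = card≡n⇒full placed card-placed
  open Realise {n} {m} k X (λ q q′ → separated q q′ (full q) (full q′))
  labels : ∀ s → psLabel n m x s ≡ a s
  labels s = begin
    psLabel n m x s                                              ≡⟨ psLabel-contributions n m x s ⟩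
    suc (sum (λ q → contribution m x q s))                       ≡⟨ cong suc (sum-cong-≗ (λ q → contribution-realised q s)) ⟩
    suc (sum (λ q → contributionℤ m (suc k) X q s))               ≡⟨ cong suc (sum-restrict-full placed full (λ q → contributionℤ m (suc k) X q s)) ⟨
    suc (sum (λ q → 𝟙 (placed q) * contributionℤ m (suc k) X q s)) ≡⟨ placed-label s (full s) ⟨
    a s                                                          ∎
    where open ≡-Reasoning

mainTheorem5 : (n m : ℕ) → 1 ≤ n → 1 ≤ m →
    ((x : Point n) → Generic n m x → IsCatalanFn n m (psLabel n m x))
    × ((a : Fin n → ℕ) → IsCatalanFn n m a →
    Σ (Point n) λ x → Generic n m x × (∀ k → psLabel n m x k ≡ a k))
    × ((x y : Point n) → Generic n m x → Generic n m y →
    (∀ k → psLabel n m x k ≡ psLabel n m y k) → SameRegion n m x y)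
mainTheorem5 n m _ _ =
  (λ x gen → psLabel-catalan {n} {m} {x} gen) ,
  catalan⇒label ,
  (λ x y gx gy same → sameRegion {n} {m} {x} {y} gx gy same)
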